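{- Let $R$ be a non-zero ring with unity whose characteristic $\operatorname{char} R$ is positive, let $M$ be a finite $R$-module with $m=|M|$, and suppose $m$ is a multiple of $\operatorname{char} R$. Let $A,B$ be non-empty subsets of $R$. Then $C_{A,B}(M)\leq m^2$ and $E_{A,B}(M)\leq 2m-1$.
   Context: A sequence of length $k$ in a set $X$ is an element of $X^k$; a subsequence is a non-empty subfamily of terms taken in the original order, and a subsequence having consecutive terms is one of the form $(x_i,x_{i+1},\ldots,x_j)$. A sequence $(x_1,\ldots,x_k)$ in $M$ is an $(A,B)$-weighted zero-sum sequence if there exist $a_1,\ldots,a_k\in A$ and $b_1,\ldots,b_k\in B$ with $a_1x_1+\cdots+a_kx_k=0$ and $b_1a_1+\cdots+b_ka_k=0$. $C_{A,B}(M)$ is the least positive integer $k$ such that every sequence in $M$ of length $k$ has an $(A,B)$-weighted zero-sum subsequence having consecutive terms; $E_{A,B}(M)$ is the least positive integer $k$ such that every sequence in $M$ of length $k$ has an $(A,B)$-weighted zero-sum subsequence of length $|M|$. (The claim includes that these least integers exist.) -}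

module Defs where

open import Level using (Level; _⊔_)
open import Data.Nat using (ℕ; zero; suc) renaming (_+_ to _+ℕ_; _≤_ to _≤ℕ_; _<_ to _<ℕ_)
open import Data.Nat.Divisibility using (_∣_)
open import Data.Fin using (Fin; toℕ)
import Data.Fin as F
open import Data.Product using (Σ; ∃; _×_; _,_)
open import Relation.Binary.PropositionalEquality using (_≡_)
open import Relation.Nullary using (¬_)
open import Relation.Unary using (Pred)
open import Algebra.Bundles using (Ring)
open import Algebra.Module.Bundles using (LeftModule)

module _ {r ℓr : Level} (R : Ring r ℓr) where
  open Ring R

  natCast : ℕ → Carrier
  natCast zero = 0#
  natCast (suc n) = 1# + natCast n

  NonZeroRing : Set ℓr
  NonZeroRing = ¬ (1# ≈ 0#)

  -- char R = n: n is the least positive integer with n · 1 = 0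
  -- (char R = 0 is the case that no such positive n exists)
  HasCharacteristic : ℕ → Set ℓr
  HasCharacteristic n = (0 <ℕ n) × (natCast n ≈ 0#)
                        × (∀ j → 0 <ℕ j → j <ℕ n → ¬ (natCast j ≈ 0#))

  sumR : ∀ {k} → (Fin k → Carrier) → Carrier
  sumR {zero} f = 0#
  sumR {suc k} f = f F.zero + sumR (λ i → f (F.suc i))

module _ {r ℓr m ℓm : Level} {R : Ring r ℓr} (M : LeftModule R m ℓm) where
  open Ring R
  open LeftModule M

  sumM : ∀ {k} → (Fin k → Carrierᴹ) → Carrierᴹ
  sumM {zero} f = 0ᴹ
  sumM {suc k} f = f F.zero +ᴹ sumM (λ i → f (F.suc i))

  record HasSize (n : ℕ) : Set (m ⊔ ℓm) where
    field
      enum       : Fin n → Carrierᴹ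
      injective  : ∀ i j → enum i ≈ᴹ enum j → i ≡ j
      surjective : ∀ x → ∃ λ i → enum i ≈ᴹ x

  Seq : ℕ → Set m
  Seq k = Fin k → Carrierᴹ

  WeightedZeroSum : ∀ {ℓa ℓb} → Pred Carrier ℓa → Pred Carrier ℓb
                    → ∀ {k} → Seq k → Set (r ⊔ ℓr ⊔ ℓm ⊔ ℓa ⊔ ℓb)
  WeightedZeroSum A B {k} x =
    Σ (Fin k → Carrier) λ a → Σ (Fin k → Carrier) λ b →
      (∀ i → A (a i)) × (∀ i → B (b i))
      × (sumM (λ i → a i *ₗ x i) ≈ᴹ 0ᴹ)
      × (sumR R (λ i → b i * a i) ≈ 0#)

  -- subsequence of x (length k) of length l ≥ 1: strictly increasing σ : Fin l → Fin k
  StrictlyIncreasing : ∀ {l k} → (Fin l → Fin k) → Set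
  StrictlyIncreasing σ = ∀ i j → toℕ i <ℕ toℕ j → toℕ (σ i) <ℕ toℕ (σ j)

  HasConsecutiveWZS : ∀ {ℓa ℓb} → Pred Carrier ℓa → Pred Carrier ℓb
                      → ∀ {k} → Seq k → Set (r ⊔ ℓr ⊔ ℓm ⊔ ℓa ⊔ ℓb)
  HasConsecutiveWZS A B {k} x =
    Σ ℕ λ l → Σ (Fin l → Fin k) λ σ →
      (0 <ℕ l) × StrictlyIncreasing σ
      × (Σ ℕ λ s → ∀ i → toℕ (σ i) ≡ s +ℕ toℕ i)
      × WeightedZeroSum A B (λ i → x (σ i))

  HasWZSOfLength : ∀ {ℓa ℓb} → Pred Carrier ℓa → Pred Carrier ℓb
                   → ℕ → ∀ {k} → Seq k → Set (r ⊔ ℓr ⊔ ℓm ⊔ ℓa ⊔ ℓb)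
  HasWZSOfLength A B n {k} x =
    Σ (Fin n → Fin k) λ σ → (0 <ℕ n) × StrictlyIncreasing σ
      × WeightedZeroSum A B (λ i → x (σ i))

  -- "C_{A,B}(M) ≤ N": the least positive k such that every sequence of length k
  -- has a consecutive weighted zero-sum subsequence exists and is ≤ N,
  -- i.e. some positive k ≤ N has this property.
  C-atMost : ∀ {ℓa ℓb} → Pred Carrier ℓa → Pred Carrier ℓb → ℕ
             → Set (r ⊔ ℓr ⊔ m ⊔ ℓm ⊔ ℓa ⊔ ℓb)
  C-atMost A B N = Σ ℕ λ k → (0 <ℕ k) × (k ≤ℕ N) × (∀ (x : Seq k) → HasConsecutiveWZS A B x)

  -- "E_{A,B}(M) ≤ N" where n = |M|
  E-atMost : ∀ {ℓa ℓb} → Pred Carrier ℓa → Pred Carrier ℓb → ℕ → ℕ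
             → Set (r ⊔ ℓr ⊔ m ⊔ ℓm ⊔ ℓa ⊔ ℓb)
  E-atMost A B n N = Σ ℕ λ k → (0 <ℕ k) × (k ≤ℕ N) × (∀ (x : Seq k) → HasWZSOfLength A B n x)

-- Fix a ∈ A and b ∈ B and use them as all the weights: a zero-sum sequence whose length l is a
-- multiple of c = char R is then (A,B)-weighted zero-sum, as its second condition reads l · ba = 0.
-- For C: among the n·c + 1 prefixes of a sequence of length n·c ≤ n², two agree both in partial
-- sum and in length modulo c, and the terms between them form such a block.  For E: since c ∣ n,
-- it suffices that any 2n − 1 elements of the additive group of M (of order n) contain n summing
-- to zero.  This is the Erdős–Ginzburg–Ziv theorem, proved by induction on the order: for ℤ/p
-- the sumsets {a₁, b₁} + ⋯ + {aⱼ, bⱼ} of pairs of distinct residues grow until they cover ℤ/p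
-- (Cauchy–Davenport); in general one splits off a subgroup H of prime order p, extracts 2p − 1
-- disjoint blocks of size n/p whose sums lie in H from the quotient, and applies the prime case
-- to the block sums.

module Submission where

open import Defs
open import Level using (Level; _⊔_)
open import Function using (_∘_; const; case_of_)
import Data.Vec.Functional as Vector
import Data.Bool as Bool
open Bool using (Bool; true; false; _∧_; _∨_; not)
open import Data.Bool.Properties using (¬-not)
open import Data.Nat as ℕ using (ℕ; zero; suc; _+_; _*_; _∸_; _≤_; _<_; _<?_; z≤n; s≤s; NonZero; >-nonZero; nonTrivial⇒n>1; _%_; _/_)
open import Data.Nat.Properties
open import Data.Nat.DivMod
open import Data.Nat.Induction using (<-rec)
open import Data.Nat.Solver using (module +-*-Solver)
open import Data.Nat.Divisibility using (_∣_; divides; ∣⇒≤; n∣m⇒m%n≡0)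
open import Relation.Unary using (Pred)
open import Data.Nat.Primality using (Prime; euclidsLemma; prime⇒nonZero; prime⇒nonTrivial)
open import Data.Nat.Primality.Factorisation using (factorise; PrimeFactorisation)
open import Data.Nat.ListAction using (product)
open import Data.List using ([]; _∷_)
open import Data.List.Relation.Unary.All using (_∷_)
open import Data.Fin as Fin using (Fin; zero; suc; toℕ; fromℕ<)
import Data.Fin.Properties as Finₚ
open import Data.Product using (Σ; ∃; _×_; _,_; proj₁; proj₂; uncurry)
open import Data.Sum using (_⊎_; inj₁; inj₂; [_,_]′)
open import Data.Empty using (⊥-elim)
open import Relation.Binary.PropositionalEquality as ≡
  using (_≡_; _≢_; refl; sym; trans; cong; cong₂; subst; subst₂)
open import Relation.Nullary using (¬_; Dec; yes; no; does; contradiction)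
open import Relation.Binary.Definitions using (tri<; tri≈; tri>)
open import Relation.Nullary.Decidable using (dec-true; dec-false; map′; _×-dec_; _→-dec_; ¬?)
open import Algebra.Bundles using (CommutativeMonoid; AbelianGroup; Ring)
open import Algebra.Module.Bundles using (LeftModule)

dec-true⁻¹ : ∀ {a} {A : Set a} (a? : Dec A) → does a? ≡ true → A
dec-true⁻¹ (yes a) _ = a

-- Index masks and masked sums

Mask : ℕ → Set
Mask k = Fin k → Bool

module _ {k : ℕ} where

  infix 4 _∈_ _∉_ _⊆_

  _∈_ : Fin k → Mask k → Set
  i ∈ S = S i ≡ true

  _∉_ : Fin k → Mask k → Set
  i ∉ S = S i ≡ false

  _⊆_ : Mask k → Mask k → Set
  S ⊆ U = ∀ i → i ∈ S → i ∈ U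

  Disjoint : Mask k → Mask k → Set
  Disjoint S U = ∀ i → i ∈ S → i ∉ U

  ∅ : Mask k
  ∅ _ = false

  full : Mask k
  full _ = true

  ⁅_⁆ : Fin k → Mask k
  ⁅ a ⁆ i = does (a Fin.≟ i)

  infixr 6 _∪_
  infixl 7 _∩_ _∖_

  _∪_ : Mask k → Mask k → Mask k
  (S ∪ U) i = S i ∨ U i

  _∩_ : Mask k → Mask k → Mask k
  (S ∩ U) i = S i ∧ U i

  _∖_ : Mask k → Mask k → Mask k
  (S ∖ U) i = S i ∧ not (U i)

  ∈⁅⁆ : ∀ a → a ∈ ⁅ a ⁆
  ∈⁅⁆ a = dec-true (a Fin.≟ a) refl

  ∈⁅⁆⁻¹ : ∀ a {i} → i ∈ ⁅ a ⁆ → a ≡ i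
  ∈⁅⁆⁻¹ a {i} = dec-true⁻¹ (a Fin.≟ i)

  ∉⁅⁆ : ∀ a {i} → a ≢ i → i ∉ ⁅ a ⁆
  ∉⁅⁆ a {i} a≢i = dec-false (a Fin.≟ i) a≢i

  ∈-∪⁻ : ∀ S U {i} → i ∈ S ∪ U → i ∈ S ⊎ i ∈ U
  ∈-∪⁻ S U {i} i∈ with S i
  ... | true = inj₁ refl
  ... | false = inj₂ i∈

  ∈-∪⁺ˡ : ∀ S U {i} → i ∈ S → i ∈ S ∪ U
  ∈-∪⁺ˡ S U i∈S rewrite i∈S = refl

  ∈-∪⁺ʳ : ∀ S U {i} → i ∈ U → i ∈ S ∪ U
  ∈-∪⁺ʳ S U {i} i∈U rewrite i∈U with S i
  ... | true = refl
  ... | false = refl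

  ∈-∩⁻ : ∀ S U {i} → i ∈ S ∩ U → i ∈ S × i ∈ U
  ∈-∩⁻ S U {i} i∈ with S i | U i
  ... | true | true = refl , refl

  ∈-∩⁺ : ∀ S U {i} → i ∈ S → i ∈ U → i ∈ S ∩ U
  ∈-∩⁺ S U i∈S i∈U rewrite i∈S | i∈U = refl

  ∈-∖⁻ : ∀ S U {i} → i ∈ S ∖ U → i ∈ S × i ∉ U
  ∈-∖⁻ S U {i} i∈ with S i | U i
  ... | true | false = refl , refl

  ∈-∖⁺ : ∀ S U {i} → i ∈ S → i ∉ U → i ∈ S ∖ U
  ∈-∖⁺ S U i∈S i∉U rewrite i∈S | i∉U = refl

  ∪-⊆ : ∀ {S U V} → S ⊆ V → U ⊆ V → S ∪ U ⊆ V
  ∪-⊆ {S} {U} S⊆V U⊆V i i∈ = [ S⊆V i , U⊆V i ]′ (∈-∪⁻ S U i∈)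

  ⁅⁆-⊆ : ∀ {a S} → a ∈ S → ⁅ a ⁆ ⊆ S
  ⁅⁆-⊆ {a} {S} a∈S i i∈ = subst (_∈ S) (∈⁅⁆⁻¹ a i∈) a∈S

  ∖-⊆ : ∀ S U → S ∖ U ⊆ S
  ∖-⊆ S U i i∈ = proj₁ (∈-∖⁻ S U i∈)

  ∉-⊆ : ∀ {S U i} → S ⊆ U → i ∉ U → i ∉ S
  ∉-⊆ {S} {U} {i} S⊆U i∉U with S i in eq
  ... | false = refl
  ... | true = contradiction (trans (sym (S⊆U i eq)) i∉U) λ ()

  ∖-disjoint : ∀ S U → Disjoint (S ∖ U) U
  ∖-disjoint S U i i∈ = proj₂ (∈-∖⁻ S U i∈)

  disjoint-sym : ∀ {S U} → Disjoint S U → Disjoint U S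
  disjoint-sym {S} {U} d i i∈U with S i in eq
  ... | false = refl
  ... | true = contradiction (trans (sym i∈U) (d i eq)) λ ()

  disjoint-⊆ : ∀ {S S′ U U′} → S′ ⊆ S → U′ ⊆ U → Disjoint S U → Disjoint S′ U′
  disjoint-⊆ S′⊆S U′⊆U d i i∈ = ∉-⊆ U′⊆U (d i (S′⊆S i i∈))

  disjoint-⁅⁆ : ∀ {S a} → a ∉ S → Disjoint S ⁅ a ⁆
  disjoint-⁅⁆ {a = a} a∉S i i∈S = ∉⁅⁆ a λ { refl → contradiction (trans (sym i∈S) a∉S) λ () }

⋃ : ∀ {K k} → Mask K → (Fin K → Mask k) → Mask k
⋃ {zero} J B = ∅
⋃ {suc K} J B = const (J zero) ∩ B zero ∪ ⋃ (J ∘ suc) (B ∘ suc)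

PairwiseDisjoint : ∀ {K k} → (Fin K → Mask k) → Set
PairwiseDisjoint B = ∀ j j′ → j ≢ j′ → Disjoint (B j) (B j′)

∈-⋃⁻ : ∀ {K k} (J : Mask K) (B : Fin K → Mask k) {i} → i ∈ ⋃ J B → ∃ λ j → j ∈ J × i ∈ B j
∈-⋃⁻ {suc K} J B {i} i∈ with ∈-∪⁻ (const (J zero) ∩ B zero) (⋃ (J ∘ suc) (B ∘ suc)) i∈
... | inj₁ i∈B₀ = zero , ∈-∩⁻ (const (J zero)) (B zero) i∈B₀
... | inj₂ i∈⋃ with ∈-⋃⁻ (J ∘ suc) (B ∘ suc) i∈⋃
...   | j , j∈J , i∈Bj = suc j , j∈J , i∈Bj

∈-⋃⁺ : ∀ {K k} (J : Mask K) (B : Fin K → Mask k) j → j ∈ J → B j ⊆ ⋃ J B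
∈-⋃⁺ J B zero j∈J i i∈Bj rewrite j∈J | i∈Bj = refl
∈-⋃⁺ J B (suc j) j∈J i i∈Bj =
  ∈-∪⁺ʳ (const (J zero) ∩ B zero) (⋃ (J ∘ suc) (B ∘ suc)) (∈-⋃⁺ (J ∘ suc) (B ∘ suc) j j∈J i i∈Bj)

⋃-⊆ : ∀ {K k} (J : Mask K) (B : Fin K → Mask k) {T} → (∀ j → B j ⊆ T) → ⋃ J B ⊆ T
⋃-⊆ J B B⊆T i i∈ with ∈-⋃⁻ J B i∈
... | j , _ , i∈Bj = B⊆T j i i∈Bj

disjoint-⋃ : ∀ {K k} {S : Mask k} (J : Mask K) (B : Fin K → Mask k) →
             (∀ j → Disjoint S (B j)) → Disjoint S (⋃ J B)
disjoint-⋃ J B d i i∈S = ¬-not λ i∈⋃ → case ∈-⋃⁻ J B i∈⋃ of λ where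
  (j , _ , i∈Bj) → contradiction (trans (sym i∈Bj) (d j i i∈S)) λ ()

-- Only the operations enter the definition, so that a quotient (same operations, coarser
-- equality) has definitionally the same sums.
module RawMaskedSum {c : Level} {C : Set c} (_∙_ : C → C → C) (ε : C) where

  select : Bool → C → C
  select true x = x
  select false _ = ε

  ∑⟨_⟩ : ∀ {k} → Mask k → (Fin k → C) → C
  ∑⟨ S ⟩ f = Vector.foldr _∙_ ε (λ i → select (S i) (f i))

module MaskedSum {c ℓ : Level} (CM : CommutativeMonoid c ℓ) where
  open CommutativeMonoid CM renaming (refl to ≈-refl; sym to ≈-sym; trans to ≈-trans)
  open import Algebra.Properties.Monoid.Sum monoid using (sum; sum-cong-≋; sum-replicate-zero)
  open import Algebra.Properties.CommutativeMonoid.Sum CM using (∑-distrib-+)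
  open import Relation.Binary.Reasoning.Setoid setoid
  open RawMaskedSum _∙_ ε public

  ∑-∅ : ∀ {k} (f : Fin k → Carrier) → ∑⟨ ∅ ⟩ f ≈ ε
  ∑-∅ {k} _ = sum-replicate-zero k

  ∑-cong : ∀ {k} (S : Mask k) {f g : Fin k → Carrier} → (∀ i → i ∈ S → f i ≈ g i) → ∑⟨ S ⟩ f ≈ ∑⟨ S ⟩ g
  ∑-cong S {f} {g} f≈g = sum-cong-≋ pointwise
    where
    pointwise : ∀ i → select (S i) (f i) ≈ select (S i) (g i)
    pointwise i with S i in i∈S
    ... | true = f≈g i i∈S
    ... | false = ≈-refl

  ∑-∪ : ∀ {k} (S U : Mask k) (f : Fin k → Carrier) → Disjoint S U → ∑⟨ S ∪ U ⟩ f ≈ ∑⟨ S ⟩ f ∙ ∑⟨ U ⟩ f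
  ∑-∪ S U f d = ≈-trans (sum-cong-≋ pointwise) (∑-distrib-+ (λ i → select (S i) (f i)) (λ i → select (U i) (f i)))
    where
    pointwise : ∀ i → select (S i ∨ U i) (f i) ≈ select (S i) (f i) ∙ select (U i) (f i)
    pointwise i with S i in i∈S | U i in i∈U
    ... | true | false = ≈-sym (identityʳ _)
    ... | false | true = ≈-sym (identityˡ _)
    ... | false | false = ≈-sym (identityˡ _)
    ... | true | true = contradiction (trans (sym i∈U) (d i i∈S)) λ ()

  ∑-⁅⁆ : ∀ {k} (a : Fin k) (f : Fin k → Carrier) → ∑⟨ ⁅ a ⁆ ⟩ f ≈ f a
  ∑-⁅⁆ {suc k} zero f = ≈-trans (∙-congˡ (∑-∅ (f ∘ suc))) (identityʳ _)
  ∑-⁅⁆ {suc k} (suc a) f = ≈-trans (identityˡ _) (∑-⁅⁆ a (f ∘ suc))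

  ∑-⋃ : ∀ {K k} (J : Mask K) (B : Fin K → Mask k) (f : Fin k → Carrier) → PairwiseDisjoint B →
        ∑⟨ ⋃ J B ⟩ f ≈ ∑⟨ J ⟩ (λ j → ∑⟨ B j ⟩ f)
  ∑-⋃ {zero} J B f _ = ∑-∅ f
  ∑-⋃ {suc K} J B f pd = begin
    ∑⟨ B₀ ∪ ⋃ (J ∘ suc) (B ∘ suc) ⟩ f
      ≈⟨ ∑-∪ B₀ _ f (disjoint-⋃ (J ∘ suc) (B ∘ suc) λ j i i∈B₀ →
           pd zero (suc j) (λ ()) i (proj₂ (∈-∩⁻ (const (J zero)) (B zero) i∈B₀))) ⟩
    ∑⟨ B₀ ⟩ f ∙ ∑⟨ ⋃ (J ∘ suc) (B ∘ suc) ⟩ f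
      ≈⟨ ∙-cong (head (J zero)) (∑-⋃ (J ∘ suc) (B ∘ suc) f λ j j′ j≢j′ → pd (suc j) (suc j′) (j≢j′ ∘ Finₚ.suc-injective)) ⟩
    select (J zero) (∑⟨ B zero ⟩ f) ∙ ∑⟨ J ∘ suc ⟩ (λ j → ∑⟨ B (suc j) ⟩ f) ∎
    where
    B₀ = const (J zero) ∩ B zero
    head : ∀ b → ∑⟨ const b ∩ B zero ⟩ f ≈ select b (∑⟨ B zero ⟩ f)
    head true = ≈-refl
    head false = ∑-∅ f

module ℕSum = MaskedSum +-0-commutativeMonoid

count : ∀ {k} → Mask k → ℕ
count S = ℕSum.∑⟨ S ⟩ (const 1)

count-∅ : ∀ {k} → count (∅ {k}) ≡ 0
count-∅ {k} = ℕSum.∑-∅ {k} (const 1)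

count-full : ∀ {k} → count (full {k}) ≡ k
count-full {zero} = refl
count-full {suc k} = cong suc count-full

count-⁅⁆ : ∀ {k} (a : Fin k) → count ⁅ a ⁆ ≡ 1
count-⁅⁆ a = ℕSum.∑-⁅⁆ a (const 1)

count-∪ : ∀ {k} (S U : Mask k) → Disjoint S U → count (S ∪ U) ≡ count S + count U
count-∪ S U = ℕSum.∑-∪ S U (const 1)

∑ℕ-const : ∀ {K} (J : Mask K) m → ℕSum.∑⟨ J ⟩ (const m) ≡ count J * m
∑ℕ-const {zero} J m = refl
∑ℕ-const {suc K} J m with J zero
... | true = cong (m +_) (∑ℕ-const (J ∘ suc) m)
... | false = ∑ℕ-const (J ∘ suc) m

count-⊆ : ∀ {k} {S U : Mask k} → S ⊆ U → count S ≤ count U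
count-⊆ {zero} _ = z≤n
count-⊆ {suc k} {S} {U} S⊆U = +-mono-≤ (head (S zero) (U zero) (S⊆U zero)) (count-⊆ (S⊆U ∘ suc))
  where
  head : ∀ a b → (a ≡ true → b ≡ true) → ℕSum.select a 1 ≤ ℕSum.select b 1
  head false _ _ = z≤n
  head true b a⇒b rewrite a⇒b refl = ≤-refl

count-cong : ∀ {k} {S U : Mask k} → S ⊆ U → U ⊆ S → count S ≡ count U
count-cong S⊆U U⊆S = ≤-antisym (count-⊆ S⊆U) (count-⊆ U⊆S)

count-≗ : ∀ {k} {S U : Mask k} → (∀ i → S i ≡ U i) → count S ≡ count U
count-≗ S≗U = count-cong (λ i → subst (_≡ true) (S≗U i)) (λ i → subst (_≡ true) (sym (S≗U i)))

count-∖ : ∀ {k} {T U : Mask k} → U ⊆ T → count (T ∖ U) + count U ≡ count T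
count-∖ {T = T} {U} U⊆T = trans (sym (count-∪ (T ∖ U) U (∖-disjoint T U))) (count-cong ∪⊆T T⊆∪)
  where
  ∪⊆T : (T ∖ U) ∪ U ⊆ T
  ∪⊆T = ∪-⊆ (∖-⊆ T U) U⊆T
  T⊆∪ : T ⊆ (T ∖ U) ∪ U
  T⊆∪ i i∈T rewrite i∈T with U i
  ... | true = refl
  ... | false = refl

count-remove : ∀ {k} (T : Mask k) {a} → a ∈ T → count T ≡ suc (count (T ∖ ⁅ a ⁆))
count-remove T {a} a∈T = begin
  count T                               ≡⟨ sym (count-∖ {T = T} {U = ⁅ a ⁆} (⁅⁆-⊆ a∈T)) ⟩
  count (T ∖ ⁅ a ⁆) + count ⁅ a ⁆      ≡⟨ cong (count (T ∖ ⁅ a ⁆) +_) (count-⁅⁆ a) ⟩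
  count (T ∖ ⁅ a ⁆) + 1                ≡⟨ +-comm _ 1 ⟩
  suc (count (T ∖ ⁅ a ⁆))              ∎
  where open ≡.≡-Reasoning

∈⇒0<count : ∀ {k} {S : Mask k} {a} → a ∈ S → 0 < count S
∈⇒0<count {S = S} {a} a∈S = subst (_≤ count S) (count-⁅⁆ a) (count-⊆ {S = ⁅ a ⁆} {U = S} (⁅⁆-⊆ a∈S))

count-strict : ∀ {k} {S U : Mask k} {a} → S ⊆ U → a ∈ U → a ∉ S → count S < count U
count-strict {S = S} {U} {a} S⊆U a∈U a∉S =
  subst (count S <_) (trans (+-comm _ (count (U ∖ S))) (count-∖ S⊆U))
    (m<m+n (count S) (∈⇒0<count {S = U ∖ S} (∈-∖⁺ U S a∈U a∉S)))

count-<-witness : ∀ {k} (S T : Mask k) → count S < count T → ∃ λ i → i ∈ T × i ∉ S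
count-<-witness S T S<T with Finₚ.any? (λ i → T i Bool.≟ true ×-dec S i Bool.≟ false)
... | yes witness = witness
... | no none = contradiction (count-⊆ T⊆S) (<⇒≱ S<T)
  where
  T⊆S : T ⊆ S
  T⊆S i i∈T = ¬-not λ i∉S → none (i , i∈T , i∉S)

count-nonempty : ∀ {k} (S : Mask k) → 0 < count S → ∃ (_∈ S)
count-nonempty {k} S 0<S with count-<-witness ∅ S (subst (_< count S) (sym (count-∅ {k})) 0<S)
... | i , i∈S , _ = i , i∈S

choose : ∀ {k} (S : Mask k) N → N ≤ count S → ∃ λ S′ → S′ ⊆ S × count S′ ≡ N
choose {zero} S zero _ = S , (λ _ i∈ → i∈) , refl
choose {suc k} S zero _ = ∅ , (λ _ ()) , count-∅ {suc k}
choose {suc k} S (suc N) N<S with S zero in 0∈S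
... | true with choose (S ∘ suc) N (≤-pred N<S)
...   | S′ , S′⊆S , #S′ = true Vector.∷ S′ , (λ { zero _ → 0∈S ; (suc i) → S′⊆S i }) , cong suc #S′
choose {suc k} S (suc N) N<S | false with choose (S ∘ suc) (suc N) N<S
...   | S′ , S′⊆S , #S′ = false Vector.∷ S′ , (λ { zero () ; (suc i) → S′⊆S i }) , #S′

enumerate : ∀ {k} (S : Mask k) → Fin (count S) → Fin k
enumerate {suc k} S i with S zero
enumerate {suc k} S zero    | true  = zero
enumerate {suc k} S (suc i) | true  = suc (enumerate (S ∘ suc) i)
enumerate {suc k} S i       | false = suc (enumerate (S ∘ suc) i)

enumerate-∈ : ∀ {k} (S : Mask k) i → enumerate S i ∈ S
enumerate-∈ {suc k} S i with S zero in 0∈S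
enumerate-∈ {suc k} S zero    | true  = 0∈S
enumerate-∈ {suc k} S (suc i) | true  = enumerate-∈ (S ∘ suc) i
enumerate-∈ {suc k} S i       | false = enumerate-∈ (S ∘ suc) i

enumerate-increasing : ∀ {k} (S : Mask k) i j → toℕ i < toℕ j → toℕ (enumerate S i) < toℕ (enumerate S j)
enumerate-increasing {suc k} S i j i<j with S zero
enumerate-increasing {suc k} S zero    (suc j) _         | true = s≤s z≤n
enumerate-increasing {suc k} S (suc i) (suc j) (s≤s i<j) | true = s≤s (enumerate-increasing (S ∘ suc) i j i<j)
enumerate-increasing {suc k} S i       j       i<j       | false = s≤s (enumerate-increasing (S ∘ suc) i j i<j)

enumerate-surjective : ∀ {k} (S : Mask k) {j} → j ∈ S → ∃ λ i → enumerate S i ≡ j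
enumerate-surjective {suc k} S {j} j∈S with S zero in 0∈S
enumerate-surjective {suc k} S {zero} _     | true = zero , refl
enumerate-surjective {suc k} S {suc j} j∈S  | true with enumerate-surjective (S ∘ suc) j∈S
... | i , refl = suc i , refl
enumerate-surjective {suc k} S {zero} 0∈S′  | false = contradiction (trans (sym 0∈S′) 0∈S) λ ()
enumerate-surjective {suc k} S {suc j} j∈S  | false with enumerate-surjective (S ∘ suc) j∈S
... | i , refl = i , refl

enumerate-injective : ∀ {k} (S : Mask k) {i j} → enumerate S i ≡ enumerate S j → i ≡ j
enumerate-injective S {i} {j} eq with <-cmp (toℕ i) (toℕ j)
... | tri< i<j _ _ = contradiction (cong toℕ eq) (<⇒≢ (enumerate-increasing S i j i<j))
... | tri≈ _ i≡j _ = Finₚ.toℕ-injective i≡j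
... | tri> _ _ j<i = contradiction (cong toℕ (sym eq)) (<⇒≢ (enumerate-increasing S j i j<i))

injection⇒≤count : ∀ {m k} (U : Mask k) (f : Fin m → Fin k) →
                   (∀ i → f i ∈ U) → (∀ {i j} → f i ≡ f j → i ≡ j) → m ≤ count U
injection⇒≤count U f f∈U f-injective = Finₚ.injective⇒≤ {f = g} g-injective
  where
  g : _ → Fin (count U)
  g i = proj₁ (enumerate-surjective U (f∈U i))
  g-injective : ∀ {i j} → g i ≡ g j → i ≡ j
  g-injective {i} {j} gi≡gj = f-injective (begin
    f i                  ≡⟨ sym (proj₂ (enumerate-surjective U (f∈U i))) ⟩
    enumerate U (g i)    ≡⟨ cong (enumerate U) gi≡gj ⟩
    enumerate U (g j)    ≡⟨ proj₂ (enumerate-surjective U (f∈U j)) ⟩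
    f j                  ∎)
    where open ≡.≡-Reasoning

module _ {c ℓ : Level} (CM : CommutativeMonoid c ℓ) where
  open CommutativeMonoid CM renaming (refl to ≈-refl; trans to ≈-trans; sym to ≈-sym)
  open MaskedSum CM
  open import Algebra.Properties.Monoid.Sum monoid using (sum)

  sum-enumerate : ∀ {k} (S : Mask k) (f : Fin k → Carrier) → sum (f ∘ enumerate S) ≈ ∑⟨ S ⟩ f
  sum-enumerate {zero} S f = ≈-refl
  sum-enumerate {suc k} S f with S zero
  ... | true = ∙-congˡ (sum-enumerate (S ∘ suc) (f ∘ suc))
  ... | false = ≈-trans (sum-enumerate (S ∘ suc) (f ∘ suc)) (≈-sym (identityˡ _))

-- Residues modulo p

count-rotate₁ : ∀ n (P : ℕ → Bool) → count {suc n} (λ r → P ((toℕ r + 1) % suc n)) ≡ count {suc n} (P ∘ toℕ)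
count-rotate₁ n P = begin
  count {suc n} (λ r → P ((toℕ r + 1) % suc n))
    ≡⟨ sum-init-last {n} (λ r → ℕSum.select (P ((toℕ r + 1) % suc n)) 1) ⟩
  count {n} (λ r → P ((toℕ (Fin.inject₁ r) + 1) % suc n)) + ℕSum.select (P ((toℕ (Fin.fromℕ n) + 1) % suc n)) 1
    ≡⟨ cong₂ _+_ (count-≗ {n} λ r → cong P (inner r)) (cong (λ x → ℕSum.select (P x) 1) last) ⟩
  count {n} (λ r → P (suc (toℕ r))) + ℕSum.select (P 0) 1
    ≡⟨ +-comm (count {n} (λ r → P (suc (toℕ r)))) _ ⟩
  count {suc n} (P ∘ toℕ) ∎
  where
  open ≡.≡-Reasoning
  open import Algebra.Properties.Monoid.Sum +-0-monoid using (sum-init-last)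
  inner : ∀ (r : Fin n) → (toℕ (Fin.inject₁ r) + 1) % suc n ≡ suc (toℕ r)
  inner r = begin
    (toℕ (Fin.inject₁ r) + 1) % suc n ≡⟨ cong (λ x → (x + 1) % suc n) (Finₚ.toℕ-inject₁ r) ⟩
    (toℕ r + 1) % suc n              ≡⟨ cong (_% suc n) (+-comm (toℕ r) 1) ⟩
    suc (toℕ r) % suc n              ≡⟨ m<n⇒m%n≡m (s≤s (Finₚ.toℕ<n r)) ⟩
    suc (toℕ r)                      ∎
  last : (toℕ (Fin.fromℕ n) + 1) % suc n ≡ 0
  last = trans (cong (λ x → (x + 1) % suc n) (Finₚ.toℕ-fromℕ n))
               (trans (cong (_% suc n) (+-comm n 1)) (n%n≡0 (suc n)))

module Residues (q : ℕ) where

  p : ℕ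
  p = suc q

  %-absorbˡ : ∀ a b → (a % p + b) % p ≡ (a + b) % p
  %-absorbˡ a b = begin
    (a % p + b) % p           ≡⟨ %-distribˡ-+ (a % p) b p ⟩
    (a % p % p + b % p) % p   ≡⟨ cong (λ x → (x + b % p) % p) (m%n%n≡m%n a p) ⟩
    (a % p + b % p) % p       ≡⟨ sym (%-distribˡ-+ a b p) ⟩
    (a + b) % p               ∎
    where open ≡.≡-Reasoning

  %-absorbʳ : ∀ a b → (a + b % p) % p ≡ (a + b) % p
  %-absorbʳ a b = trans (cong (_% p) (+-comm a (b % p))) (trans (%-absorbˡ b a) (cong (_% p) (+-comm b a)))

  -- p ∸ a % p represents the residue of −a.
  ∸%-cancel : ∀ r a → (r + a % p + (p ∸ a % p)) % p ≡ r % p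
  ∸%-cancel r a = trans (cong (_% p) (trans (+-assoc r _ _) (cong (r +_) (m+[n∸m]≡n (m%n≤n a p)))))
                        ([m+n]%n≡m%n r p)

  add-sub : ∀ r a → ((r + a) % p + (p ∸ a % p)) % p ≡ r % p
  add-sub r a = begin
    ((r + a) % p + (p ∸ a % p)) % p     ≡⟨ cong (λ x → (x + (p ∸ a % p)) % p) (sym (%-absorbʳ r a)) ⟩
    ((r + a % p) % p + (p ∸ a % p)) % p ≡⟨ %-absorbˡ (r + a % p) _ ⟩
    (r + a % p + (p ∸ a % p)) % p       ≡⟨ ∸%-cancel r a ⟩
    r % p                               ∎
    where open ≡.≡-Reasoning

  sub-add : ∀ r a → ((r + (p ∸ a % p)) % p + a) % p ≡ r % p
  sub-add r a = begin
    ((r + (p ∸ a % p)) % p + a) % p     ≡⟨ %-absorbˡ (r + (p ∸ a % p)) a ⟩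
    (r + (p ∸ a % p) + a) % p           ≡⟨ sym (%-absorbʳ (r + (p ∸ a % p)) a) ⟩
    (r + (p ∸ a % p) + a % p) % p       ≡⟨ cong (_% p) (xy∙z≈xz∙y r (p ∸ a % p) (a % p)) ⟩
    (r + a % p + (p ∸ a % p)) % p       ≡⟨ ∸%-cancel r a ⟩
    r % p                               ∎
    where
    open ≡.≡-Reasoning
    open import Algebra.Properties.CommutativeSemigroup +-commutativeSemigroup using (xy∙z≈xz∙y)

  ResidueSet : Set
  ResidueSet = ℕ → Bool

  # : ResidueSet → ℕ
  # P = count {p} (P ∘ toℕ)

  Full : ResidueSet → Set
  Full P = ∀ r → r < p → P r ≡ true

  infixl 6 _+ᵣ_

  _+ᵣ_ : ResidueSet → ℕ → ResidueSet
  (P +ᵣ a) r = P ((r + (p ∸ a % p)) % p)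

  _+ᵣ⁅_,_⁆ : ResidueSet → ℕ → ℕ → ResidueSet
  (P +ᵣ⁅ a , b ⁆) r = (P +ᵣ a) r ∨ (P +ᵣ b) r

  #-rotate : ∀ c P → # (λ r → P ((r + c) % p)) ≡ # P
  #-rotate zero P = count-≗ λ r → cong P (trans (cong (_% p) (+-identityʳ (toℕ r))) (m<n⇒m%n≡m (Finₚ.toℕ<n r)))
  #-rotate (suc c) P = begin
    # (λ r → P ((r + suc c) % p))             ≡⟨ count-≗ (λ r → cong P (shift r)) ⟩
    # (λ r → P (((r + 1) % p + c) % p))       ≡⟨ count-rotate₁ q (λ r → P ((r + c) % p)) ⟩
    # (λ r → P ((r + c) % p))                 ≡⟨ #-rotate c P ⟩
    # P                                       ∎
    where
    open ≡.≡-Reasoning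
    shift : ∀ (r : Fin p) → (toℕ r + suc c) % p ≡ ((toℕ r + 1) % p + c) % p
    shift r = sym (trans (%-absorbˡ (toℕ r + 1) c) (cong (_% p) (+-assoc (toℕ r) 1 c)))

  #-+ᵣ : ∀ P a → # (P +ᵣ a) ≡ # P
  #-+ᵣ P a = #-rotate (p ∸ a % p) P

  +ᵣ-∈ : ∀ {P : ResidueSet} {r} a → r < p → P r ≡ true → (P +ᵣ a) ((r + a) % p) ≡ true
  +ᵣ-∈ {P} {r} a r<p r∈P = subst (λ x → P x ≡ true) (sym (trans (add-sub r a) (m<n⇒m%n≡m r<p))) r∈P

  #<p : ∀ {P r} → r < p → P r ≡ false → # P < p
  #<p {P} {r} r<p r∉P = subst (# P <_) count-full
    (count-strict {S = P ∘ toℕ} {U = full} (λ _ _ → refl) refl (subst (λ x → P x ≡ false) (sym (Finₚ.toℕ-fromℕ< r<p)) r∉P))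

  p≤#⇒Full : ∀ {P} → p ≤ # P → Full P
  p≤#⇒Full {P} p≤#P r r<p with P r in r∈P
  ... | true = refl
  ... | false = contradiction p≤#P (<⇒≱ (#<p {P} r<p r∈P))

  ∑-same-residue : ∀ {k} (t : Fin k → ℕ) (S : Mask k) r → (∀ i → i ∈ S → t i % p ≡ r) →
                   ℕSum.∑⟨ S ⟩ t % p ≡ (count S * r) % p
  ∑-same-residue {zero} t S r _ = refl
  ∑-same-residue {suc k} t S r same with S zero in 0∈S
  ... | false = ∑-same-residue (t ∘ suc) (S ∘ suc) r (same ∘ suc)
  ... | true = begin
    (t zero + ℕSum.∑⟨ S ∘ suc ⟩ (t ∘ suc)) % p                 ≡⟨ %-distribˡ-+ (t zero) _ p ⟩
    (t zero % p + ℕSum.∑⟨ S ∘ suc ⟩ (t ∘ suc) % p) % p         ≡⟨ cong₂ (λ x y → (x + y) % p) (same zero 0∈S)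
                                                                     (∑-same-residue (t ∘ suc) (S ∘ suc) r (same ∘ suc)) ⟩
    (r + (count (S ∘ suc) * r) % p) % p                          ≡⟨ %-absorbʳ r (count (S ∘ suc) * r) ⟩
    (r + count (S ∘ suc) * r) % p                                ∎
    where open ≡.≡-Reasoning

%≡%⇒∣∸ : ∀ c .{{_ : NonZero c}} {i j} → i ≤ j → i % c ≡ j % c → c ∣ j ∸ i
%≡%⇒∣∸ c {i} {j} i≤j i%c≡j%c = divides (j / c ∸ i / c) (begin
  j ∸ i                                          ≡⟨ cong₂ _∸_ (m≡m%n+[m/n]*n j c) (m≡m%n+[m/n]*n i c) ⟩
  (j % c + (j / c) * c) ∸ (i % c + (i / c) * c)  ≡⟨ cong (λ x → (j % c + (j / c) * c) ∸ (x + (i / c) * c)) i%c≡j%c ⟩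
  (j % c + (j / c) * c) ∸ (j % c + (i / c) * c)  ≡⟨ [m+n]∸[m+o]≡n∸o (j % c) _ _ ⟩
  (j / c) * c ∸ (i / c) * c                      ≡⟨ sym (*-distribʳ-∸ c (j / c) (i / c)) ⟩
  (j / c ∸ i / c) * c                            ∎)
  where open ≡.≡-Reasoning

module PrimeResidues (q : ℕ) (prime : Prime (suc q)) where
  open Residues q

  orbit-no-collision : ∀ s d → d % p ≢ 0 → ∀ {i j} → i < j → j < p → (s + i * d) % p ≢ (s + j * d) % p
  orbit-no-collision s d d≢0 {i} {j} i<j j<p eq with euclidsLemma (j ∸ i) d prime
    (subst (p ∣_) (trans ([m+n]∸[m+o]≡n∸o s _ _) (sym (*-distribʳ-∸ d j i)))
      (%≡%⇒∣∸ p (+-monoʳ-≤ s (*-monoˡ-≤ d (<⇒≤ i<j))) eq))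
  ... | inj₁ p∣j∸i = <⇒≱ (≤-trans (s≤s (m∸n≤m j i)) j<p) (∣⇒≤ {{>-nonZero (m<n⇒0<n∸m i<j)}} p∣j∸i)
  ... | inj₂ p∣d = d≢0 (n∣m⇒m%n≡0 d p p∣d)

  orbit-injective : ∀ s d → d % p ≢ 0 → ∀ {i j} → i < p → j < p → (s + i * d) % p ≡ (s + j * d) % p → i ≡ j
  orbit-injective s d d≢0 {i} {j} i<p j<p eq with <-cmp i j
  ... | tri< i<j _ _ = ⊥-elim (orbit-no-collision s d d≢0 i<j j<p eq)
  ... | tri≈ _ i≡j _ = i≡j
  ... | tri> _ _ j<i = ⊥-elim (orbit-no-collision s d d≢0 j<i i<p (sym eq))

  closed⇒Full : ∀ {P : ResidueSet} d → d % p ≢ 0 → (∀ s → s < p → P s ≡ true → P ((s + d) % p) ≡ true) →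
                ∀ {s} → s < p → P s ≡ true → Full P
  closed⇒Full {P} d d≢0 closed {s} s<p s∈P = p≤#⇒Full (injection⇒≤count (P ∘ toℕ) orbit orbit∈P orbit-inj)
    where
    walk : ∀ i → P ((s + i * d) % p) ≡ true
    walk zero = subst (λ x → P x ≡ true) (sym (trans (cong (_% p) (+-identityʳ s)) (m<n⇒m%n≡m s<p))) s∈P
    walk (suc i) = subst (λ x → P x ≡ true) step (closed _ (m%n<n (s + i * d) p) (walk i))
      where
      step : ((s + i * d) % p + d) % p ≡ (s + suc i * d) % p
      step = trans (%-absorbˡ (s + i * d) d)
                   (cong (_% p) (trans (+-assoc s (i * d) d) (cong (s +_) (+-comm (i * d) d))))
    orbit : Fin p → Fin p
    orbit i = fromℕ< (m%n<n (s + toℕ i * d) p)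
    orbit∈P : ∀ i → P (toℕ (orbit i)) ≡ true
    orbit∈P i = subst (λ x → P x ≡ true) (sym (Finₚ.toℕ-fromℕ< _)) (walk (toℕ i))
    orbit-inj : ∀ {i j} → orbit i ≡ orbit j → i ≡ j
    orbit-inj {i} {j} eq = Finₚ.toℕ-injective (orbit-injective s d d≢0 (Finₚ.toℕ<n i) (Finₚ.toℕ<n j)
      (trans (sym (Finₚ.toℕ-fromℕ< _)) (trans (cong toℕ eq) (Finₚ.toℕ-fromℕ< _))))

  Large : ResidueSet → ℕ → Set
  Large P n = Full P ⊎ n < # P

  Large⇒Full : ∀ {P} → Large P q → Full P
  Large⇒Full (inj₁ full) = full
  Large⇒Full (inj₂ q<#P) = p≤#⇒Full q<#P

  Full-+ᵣ⁅⁆ : ∀ {P} a b → Full P → Full (P +ᵣ⁅ a , b ⁆)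
  Full-+ᵣ⁅⁆ a _ full r r<p rewrite full ((r + (p ∸ a % p)) % p) (m%n<n (r + (p ∸ a % p)) p) = refl

  -- Cauchy–Davenport step: if P + b ⊆ P + a then P is closed under adding b − a ≢ 0, hence full.
  Large-+ᵣ⁅⁆ : ∀ {P n} a b → a % p ≢ b % p → Large P n → Large (P +ᵣ⁅ a , b ⁆) (suc n)
  Large-+ᵣ⁅⁆ a b _ (inj₁ full) = inj₁ (Full-+ᵣ⁅⁆ a b full)
  Large-+ᵣ⁅⁆ {P} {n} a b a≢b (inj₂ n<#P)
    with Finₚ.any? (λ r → (P +ᵣ b) (toℕ r) Bool.≟ true ×-dec (P +ᵣ a) (toℕ r) Bool.≟ false)
  ... | yes (r , r∈P+b , r∉P+a) = inj₂ (begin-strict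
    suc n                  ≤⟨ n<#P ⟩
    # P                    ≡⟨ sym (#-+ᵣ P a) ⟩
    # (P +ᵣ a)             <⟨ count-strict {S = (P +ᵣ a) ∘ toℕ} {U = (P +ᵣ⁅ a , b ⁆) ∘ toℕ} {a = r}
                                (λ i → ∈-∪⁺ˡ ((P +ᵣ a) ∘ toℕ) ((P +ᵣ b) ∘ toℕ) {i})
                                (∈-∪⁺ʳ ((P +ᵣ a) ∘ toℕ) ((P +ᵣ b) ∘ toℕ) {r} r∈P+b) r∉P+a ⟩
    # (P +ᵣ⁅ a , b ⁆)      ∎)
    where open ≤-Reasoning
  ... | no none = inj₁ (Full-+ᵣ⁅⁆ a b (closed⇒Full {P} (b + (p ∸ a % p)) d≢0 closed (Finₚ.toℕ<n s) s∈P))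
    where
    d≢0 : (b + (p ∸ a % p)) % p ≢ 0
    d≢0 d≡0 = a≢b (trans (sym (cong (λ x → (x + a) % p) d≡0)) (sub-add b a))
    closed : ∀ s → s < p → P s ≡ true → P ((s + (b + (p ∸ a % p))) % p) ≡ true
    closed s s<p s∈P with (P +ᵣ a) ((s + b) % p) in r∈P+a
    ... | true = subst (λ x → P x ≡ true)
                   (trans (%-absorbˡ (s + b) (p ∸ a % p)) (cong (_% p) (+-assoc s b (p ∸ a % p)))) r∈P+a
    ... | false = ⊥-elim (none (fromℕ< r<p ,
                    subst (λ x → (P +ᵣ b) x ≡ true) (sym (Finₚ.toℕ-fromℕ< r<p)) (+ᵣ-∈ {P} b s<p s∈P) ,
                    subst (λ x → (P +ᵣ a) x ≡ false) (sym (Finₚ.toℕ-fromℕ< r<p)) r∈P+a))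
      where r<p = m%n<n (s + b) p
    nonempty = count-nonempty (P ∘ toℕ) (≤-trans (s≤s z≤n) n<#P)
    s = proj₁ nonempty
    s∈P = proj₂ nonempty

-- The Erdős–Ginzburg–Ziv theorem modulo a prime

module PrimeEGZ (q : ℕ) (prime : Prime (suc q)) {k : ℕ} (t : Fin k → ℕ) where
  open Residues q
  open PrimeResidues q prime

  ∑ : Mask k → ℕ
  ∑ S = ℕSum.∑⟨ S ⟩ t

  residue : Fin k → ℕ
  residue i = t i % p

  class : ℕ → Mask k
  class r i = does (residue i ℕ.≟ r)

  ∈-class⁻ : ∀ {r i} → i ∈ class r → residue i ≡ r
  ∈-class⁻ {r} {i} = dec-true⁻¹ (residue i ℕ.≟ r)

  ∈-class⁺ : ∀ i → i ∈ class (residue i)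
  ∈-class⁺ i = dec-true (residue i ℕ.≟ residue i) refl

  mult : Mask k → ℕ → ℕ
  mult T r = count (T ∩ class r)

  mult-⊆ : ∀ {T U} r → T ⊆ U → mult T r ≤ mult U r
  mult-⊆ {T} {U} r T⊆U = count-⊆ λ i i∈ →
    let i∈T , i∈C = ∈-∩⁻ T (class r) i∈ in ∈-∩⁺ U (class r) (T⊆U i i∈T) i∈C

  mult-≥p : ∀ T {r} → p ≤ r → mult T r ≡ 0
  mult-≥p T {r} p≤r = n≤0⇒n≡0 (subst (mult T r ≤_) (count-∅ {k}) (count-⊆ {S = T ∩ class r} {U = ∅} T∩C⊆∅))
    where
    T∩C⊆∅ : T ∩ class r ⊆ ∅
    T∩C⊆∅ i i∈ = contradiction (subst (_< p) (∈-class⁻ (proj₂ (∈-∩⁻ T (class r) i∈))) (m%n<n (t i) p)) (≤⇒≯ p≤r)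

  mult-disjoint : ∀ T {r w} → r ≢ w → mult T r + mult T w ≤ count T
  mult-disjoint T {r} {w} r≢w = subst (_≤ count T) (count-∪ (T ∩ class r) (T ∩ class w) disjoint)
    (count-⊆ {S = T ∩ class r ∪ T ∩ class w} {U = T} (∪-⊆ (λ i i∈ → proj₁ (∈-∩⁻ T (class r) i∈)) (λ i i∈ → proj₁ (∈-∩⁻ T (class w) i∈))))
    where
    disjoint : Disjoint (T ∩ class r) (T ∩ class w)
    disjoint i i∈r = ¬-not λ i∈w → r≢w (trans (sym (∈-class⁻ (proj₂ (∈-∩⁻ T (class r) i∈r))))
                                                (∈-class⁻ (proj₂ (∈-∩⁻ T (class w) i∈w))))

  insert : ∀ S x → x ∉ S → count (S ∪ ⁅ x ⁆) ≡ suc (count S) × ∑ (S ∪ ⁅ x ⁆) ≡ ∑ S + t x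
  insert S x x∉S =
    trans (count-∪ S ⁅ x ⁆ (disjoint-⁅⁆ x∉S)) (trans (cong (count S +_) (count-⁅⁆ x)) (+-comm (count S) 1)) ,
    trans (ℕSum.∑-∪ S ⁅ x ⁆ t (disjoint-⁅⁆ x∉S)) (cong (∑ S +_) (ℕSum.∑-⁅⁆ x t))

  record Pair (T : Mask k) (n : ℕ) : Set where
    field
      a b : Fin k
      a∈T : a ∈ T
      b∈T : b ∈ T
      residue-a≢b : residue a ≢ residue b
      others≤ : ∀ r → r ≢ residue a → mult T r ≤ suc n

  pair-with : ∀ {T n} a → a ∈ T → (∀ r → r ≢ residue a → mult T r ≤ suc n) →
              mult T (residue a) < count T → Pair T n
  pair-with {T} a a∈T others≤ a-class<T with count-<-witness (T ∩ class (residue a)) T a-class<T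
  ... | b , b∈T , b∉ = record
    { a = a ; b = b ; a∈T = a∈T ; b∈T = b∈T ; others≤ = others≤
    ; residue-a≢b = λ eq → contradiction (trans (sym (∈-∩⁺ T (class (residue a)) b∈T
                       (subst (λ r → b ∈ class r) (sym eq) (∈-class⁺ b)))) b∉) λ () }

  mult<count : ∀ {n T} → count T ≡ suc (suc n + suc n) → (∀ r → mult T r ≤ suc (suc n)) → ∀ r → mult T r < count T
  mult<count {n} {T} #T mult≤ r = subst (mult T r <_) (sym #T) (s≤s (≤-trans (mult≤ r) (s≤s (m≤n+m (suc n) n))))

  -- a comes from a class of n + 2 elements if there is one; any other class then has at most n + 1.
  pair : ∀ n T → count T ≡ suc (suc n + suc n) → (∀ r → mult T r ≤ suc (suc n)) → Pair T n
  pair n T #T mult≤ with Finₚ.any? (λ (r : Fin p) → mult T (toℕ r) ℕ.≟ suc (suc n))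
  ... | yes (r , full-class) = pair-with a a∈T others≤ (mult<count {T = T} #T mult≤ (residue a))
    where
    a∈ = count-nonempty (T ∩ class (toℕ r)) (subst (0 <_) (sym full-class) (s≤s z≤n))
    a = proj₁ a∈
    a∈T = proj₁ (∈-∩⁻ T (class (toℕ r)) (proj₂ a∈))
    residue-a = ∈-class⁻ (proj₂ (∈-∩⁻ T (class (toℕ r)) (proj₂ a∈)))
    others≤ : ∀ w → w ≢ residue a → mult T w ≤ suc n
    others≤ w w≢a = +-cancelʳ-≤ (suc (suc n)) (mult T w) (suc n) (begin
      mult T w + suc (suc n)        ≡⟨ cong (mult T w +_) (sym full-class) ⟩
      mult T w + mult T (toℕ r)     ≤⟨ mult-disjoint T (λ w≡r → w≢a (trans w≡r (sym residue-a))) ⟩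
      count T                       ≡⟨ #T ⟩
      suc (suc n + suc n)           ≡⟨ sym (+-suc (suc n) (suc n)) ⟩
      suc n + suc (suc n)           ∎)
      where open ≤-Reasoning
  ... | no no-full-class = pair-with a a∈T others≤ (mult<count {T = T} #T mult≤ (residue a))
    where
    a∈ = count-nonempty T (subst (0 <_) (sym #T) (s≤s z≤n))
    a = proj₁ a∈
    a∈T = proj₂ a∈
    others≤ : ∀ w → w ≢ residue a → mult T w ≤ suc n
    others≤ w _ with w <? p
    ... | no w≮p = subst (_≤ suc n) (sym (mult-≥p T (≮⇒≥ w≮p))) z≤n
    ... | yes w<p = ≤-pred (≤∧≢⇒< (mult≤ w) λ eq →
                      no-full-class (fromℕ< w<p , trans (cong (mult T) (Finₚ.toℕ-fromℕ< w<p)) eq))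

  module _ {T : Mask k} {n : ℕ} (pr : Pair T n) where
    open Pair pr

    rest : Mask k
    rest = T ∖ ⁅ a ⁆ ∖ ⁅ b ⁆

    a≢b : a ≢ b
    a≢b a≡b = residue-a≢b (cong residue a≡b)

    rest⊆T : rest ⊆ T
    rest⊆T i i∈ = ∖-⊆ T ⁅ a ⁆ i (∖-⊆ (T ∖ ⁅ a ⁆) ⁅ b ⁆ i i∈)

    a∉rest : a ∉ rest
    a∉rest = ∉-⊆ (∖-⊆ (T ∖ ⁅ a ⁆) ⁅ b ⁆) (disjoint-sym (∖-disjoint T ⁅ a ⁆) a (∈⁅⁆ a))

    b∉rest : b ∉ rest
    b∉rest = disjoint-sym (∖-disjoint (T ∖ ⁅ a ⁆) ⁅ b ⁆) b (∈⁅⁆ b)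

    count-rest : count T ≡ suc (suc (count rest))
    count-rest = trans (count-remove T a∈T) (cong suc (count-remove (T ∖ ⁅ a ⁆) (∈-∖⁺ T ⁅ a ⁆ b∈T (∉⁅⁆ a a≢b))))

    mult-rest : mult T (residue a) ≤ suc (suc n) → ∀ r → mult rest r ≤ suc n
    mult-rest a-class≤ r with r ℕ.≟ residue a
    ... | no r≢a = ≤-trans (mult-⊆ r rest⊆T) (others≤ r r≢a)
    ... | yes refl = ≤-pred (begin-strict
      mult rest r                            ≤⟨ count-⊆ {S = rest ∩ class r} {U = C ∖ ⁅ a ⁆} rest∩C⊆ ⟩
      count (C ∖ ⁅ a ⁆)                      <⟨ ≤-reflexive (sym (count-remove C a∈C)) ⟩
      count C                                ≤⟨ a-class≤ ⟩
      suc (suc n)                            ∎)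
      where
      open ≤-Reasoning
      C = T ∩ class r
      a∈C : a ∈ C
      a∈C = ∈-∩⁺ T (class r) a∈T (∈-class⁺ a)
      rest∩C⊆ : rest ∩ class r ⊆ C ∖ ⁅ a ⁆
      rest∩C⊆ i i∈ = let i∈rest , i∈class = ∈-∩⁻ rest (class r) i∈
                         i∈T∖a , _ = ∈-∖⁻ (T ∖ ⁅ a ⁆) ⁅ b ⁆ i∈rest
                         i∈T , i∉a = ∈-∖⁻ T ⁅ a ⁆ i∈T∖a
                     in ∈-∖⁺ C ⁅ a ⁆ (∈-∩⁺ T (class r) i∈T i∈class) i∉a

  insert-residue : ∀ S x → x ∉ S → ∀ {r} → r < p → ∑ S % p ≡ (r + (p ∸ t x % p)) % p → ∑ (S ∪ ⁅ x ⁆) % p ≡ r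
  insert-residue S x x∉S {r} r<p ∑S%p = begin
    ∑ (S ∪ ⁅ x ⁆) % p                           ≡⟨ cong (_% p) (proj₂ (insert S x x∉S)) ⟩
    (∑ S + t x) % p                             ≡⟨ sym (%-absorbˡ (∑ S) (t x)) ⟩
    (∑ S % p + t x) % p                         ≡⟨ cong (λ y → (y + t x) % p) ∑S%p ⟩
    ((r + (p ∸ t x % p)) % p + t x) % p         ≡⟨ sub-add r (t x) ⟩
    r % p                                       ≡⟨ m<n⇒m%n≡m r<p ⟩
    r                                           ∎
    where open ≡.≡-Reasoning

  Reachable : Mask k → Fin k → ℕ → ℕ → Set
  Reachable T e n r = ∃ λ S → S ⊆ T × e ∉ S × count S ≡ n × ∑ S % p ≡ r

  extend : ∀ {T T′ e n r} x → T′ ⊆ T → x ∈ T → x ∉ T′ → e ∈ T′ → r < p →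
           Reachable T′ e n ((r + (p ∸ t x % p)) % p) → Reachable T e (suc n) r
  extend {T} {T′} {e} {n} {r} x T′⊆T x∈T x∉T′ e∈T′ r<p (S , S⊆T′ , e∉S , #S , ∑S%p) =
    S ∪ ⁅ x ⁆ , ∪-⊆ (λ i → T′⊆T i ∘ S⊆T′ i) (⁅⁆-⊆ {S = T} x∈T) , e∉ , trans #S∪x (cong suc #S) , insert-residue S x x∉S r<p ∑S%p
    where
    x∉S = ∉-⊆ S⊆T′ x∉T′
    #S∪x = proj₁ (insert S x x∉S)
    e∉ : e ∉ S ∪ ⁅ x ⁆
    e∉ rewrite e∉S = ∉⁅⁆ x λ { refl → contradiction (trans (sym e∈T′) x∉T′) λ () }

  record Reach (T : Mask k) (n : ℕ) : Set where
    field
      e : Fin k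
      e∈T : e ∈ T
      P : ResidueSet
      large : Large P n
      reachable : ∀ r → r < p → P r ≡ true → Reachable T e n r

  -- e is kept aside to complete a sum at the very end.  Removing two elements a, b of distinct
  -- residues and putting back either one turns the reachable residues P into P + {a, b}.
  reach : ∀ n T → count T ≡ suc (n + n) → (∀ r → mult T r ≤ suc n) → Reach T n
  reach zero T #T _ = record
    { e = e ; e∈T = e∈T ; P = λ r → does (r ℕ.≟ 0) ; large = inj₂ (∈⇒0<count {p} {S = λ r → does (toℕ r ℕ.≟ 0)} {a = zero} refl)
    ; reachable = λ r _ r≡0 → ∅ , (λ _ ()) , refl , count-∅ {k} ,
                                trans (cong (_% p) (ℕSum.∑-∅ t)) (sym (dec-true⁻¹ (r ℕ.≟ 0) r≡0)) }
    where
    e∈ = count-nonempty T (subst (0 <_) (sym #T) (s≤s z≤n))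
    e = proj₁ e∈
    e∈T = proj₂ e∈
  reach (suc n) T #T mult≤ = record
    { e = e ; e∈T = rest⊆T pr e e∈T ; P = P +ᵣ⁅ t a , t b ⁆
    ; large = Large-+ᵣ⁅⁆ (t a) (t b) residue-a≢b large ; reachable = reachable′ }
    where
    pr = pair n T #T mult≤
    open Pair pr
    #rest : count (rest pr) ≡ suc (n + n)
    #rest = trans (suc-injective (suc-injective (trans (sym (count-rest pr)) #T))) (+-suc n n)
    open Reach (reach n (rest pr) #rest (mult-rest pr (mult≤ (residue a))))
    reachable′ : ∀ r → r < p → (P +ᵣ⁅ t a , t b ⁆) r ≡ true → Reachable T e (suc n) r
    reachable′ r r<p r∈ with (P +ᵣ t a) r in r∈P+a
    ... | true = extend a (rest⊆T pr) a∈T (a∉rest pr) e∈T r<p (reachable _ (m%n<n (r + (p ∸ t a % p)) p) r∈P+a)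
    ... | false = extend b (rest⊆T pr) b∈T (b∉rest pr) e∈T r<p (reachable _ (m%n<n (r + (p ∸ t b % p)) p) r∈)

  ZeroSumOfSizeP : Mask k → Set
  ZeroSumOfSizeP T = ∃ λ S → S ⊆ T × count S ≡ p × ∑ S % p ≡ 0

  one-class : ∀ T r → p ≤ mult T r → ZeroSumOfSizeP T
  one-class T r p≤mult with choose (T ∩ class r) p p≤mult
  ... | S , S⊆ , #S = S , (λ i i∈S → proj₁ (∈-∩⁻ T (class r) (S⊆ i i∈S))) , #S , (begin
    ∑ S % p             ≡⟨ ∑-same-residue t S r (λ i i∈S → ∈-class⁻ (proj₂ (∈-∩⁻ T (class r) (S⊆ i i∈S)))) ⟩
    (count S * r) % p   ≡⟨ cong (λ n → (n * r) % p) #S ⟩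
    (p * r) % p         ≡⟨ cong (_% p) (*-comm p r) ⟩
    (r * p) % p         ≡⟨ m*n%n≡0 r p ⟩
    0                   ∎)
    where open ≡.≡-Reasoning

  small-classes : ∀ T → suc (q + q) ≤ count T → (∀ r → mult T r ≤ suc q) → ZeroSumOfSizeP T
  small-classes T 2q+1≤ mult≤ with choose T (suc (q + q)) 2q+1≤
  ... | T₀ , T₀⊆T , #T₀ = S ∪ ⁅ e ⁆ , ∪-⊆ (λ i → T₀⊆T i ∘ S⊆T₀ i) (⁅⁆-⊆ {S = T} (T₀⊆T e e∈T)) ,
                          trans (proj₁ (insert S e e∉S)) (cong suc #S) , insert-residue S e e∉S (s≤s z≤n) ∑S%p
    where
    open Reach (reach q T₀ #T₀ λ r → ≤-trans (mult-⊆ r T₀⊆T) (mult≤ r))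
    r₀ = (p ∸ t e % p) % p
    r₀<p = m%n<n (p ∸ t e % p) p
    reachable-r₀ = reachable r₀ r₀<p (Large⇒Full large r₀ r₀<p)
    S = proj₁ reachable-r₀
    S⊆T₀ = proj₁ (proj₂ reachable-r₀)
    e∉S = proj₁ (proj₂ (proj₂ reachable-r₀))
    #S = proj₁ (proj₂ (proj₂ (proj₂ reachable-r₀)))
    ∑S%p = proj₂ (proj₂ (proj₂ (proj₂ reachable-r₀)))

  egz : ∀ T → p + p ≤ suc (count T) → ZeroSumOfSizeP T
  egz T 2p≤ with Finₚ.any? (λ (r : Fin p) → p ℕ.≤? mult T (toℕ r))
  ... | yes (r , p≤mult) = one-class T (toℕ r) p≤mult
  ... | no none = small-classes T (subst (_≤ count T) (+-suc q q) (≤-pred 2p≤)) mult≤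
    where
    mult≤ : ∀ r → mult T r ≤ suc q
    mult≤ r with r <? p
    ... | no r≮p = subst (_≤ suc q) (sym (mult-≥p T (≮⇒≥ r≮p))) z≤n
    ... | yes r<p = <⇒≤ (≰⇒> λ p≤mult → none (fromℕ< r<p , subst (λ x → p ≤ mult T x) (sym (Finₚ.toℕ-fromℕ< r<p)) p≤mult))

-- Finite abelian groups

least : ∀ {q} {Q : ℕ → Set q} → (∀ m → Dec (Q m)) → ∀ {d} → Q d → ∃ λ m → Q m × (∀ j → j < m → ¬ Q j)
least {Q = Q} Q? {d} = <-rec (λ d → Q d → ∃ λ m → Q m × (∀ j → j < m → ¬ Q j)) search d
  where
  search : ∀ d → (∀ {j} → j < d → Q j → ∃ λ m → Q m × (∀ j → j < m → ¬ Q j)) →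
           Q d → ∃ λ m → Q m × (∀ j → j < m → ¬ Q j)
  search d smaller Qd with Finₚ.any? {n = d} (Q? ∘ toℕ)
  ... | yes (j , Qj) = smaller (Finₚ.toℕ<n j) Qj
  ... | no none = d , Qd , λ j j<d Qj → none (fromℕ< j<d , subst Q (sym (Finₚ.toℕ-fromℕ< j<d)) Qj)

module _ {c ℓ : Level} (G : AbelianGroup c ℓ) where
  open AbelianGroup G
  open MaskedSum commutativeMonoid

  record HasOrder (n : ℕ) : Set (c ⊔ ℓ) where
    field
      enum : Fin n → Carrier
      injective : ∀ i j → enum i ≈ enum j → i ≡ j
      surjective : ∀ x → ∃ λ i → enum i ≈ x

  -- Erdős–Ginzburg–Ziv; the bound N + N ≤ suc (count T) says that T holds at least 2N − 1 terms.
  EGZ : ℕ → Set (c ⊔ ℓ)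
  EGZ N = ∀ {k} (x : Fin k → Carrier) (T : Mask k) → N + N ≤ suc (count T) →
          ∃ λ S → S ⊆ T × count S ≡ N × ∑⟨ S ⟩ x ≈ ε

module Multiples {c ℓ : Level} (G : AbelianGroup c ℓ) where
  open AbelianGroup G renaming (refl to ≈-refl; sym to ≈-sym; trans to ≈-trans)
  open MaskedSum commutativeMonoid
  open import Algebra.Definitions.RawMonoid rawMonoid public using () renaming (_×_ to _·_)
  open import Algebra.Properties.Monoid.Mult monoid public using (×-homo-+; ×-assocˡ; ×-congʳ; ×-congˡ)
  open import Algebra.Properties.Group group using (inverseʳ-unique)
  open import Relation.Binary.Reasoning.Setoid setoid

  ·-ε : ∀ n → n · ε ≈ ε
  ·-ε zero = ≈-refl
  ·-ε (suc n) = ≈-trans (identityˡ _) (·-ε n)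

  ·-% : ∀ p .{{_ : NonZero p}} {h} → p · h ≈ ε → ∀ a → a · h ≈ (a % p) · h
  ·-% p {h} p·h≈ε a = begin
    a · h                              ≡⟨ cong (_· h) (m≡m%n+[m/n]*n a p) ⟩
    (a % p + (a / p) * p) · h          ≈⟨ ×-homo-+ h (a % p) ((a / p) * p) ⟩
    (a % p) · h ∙ ((a / p) * p) · h    ≈⟨ ∙-congˡ (≈-sym (×-assocˡ h (a / p) p)) ⟩
    (a % p) · h ∙ (a / p) · (p · h)    ≈⟨ ∙-congˡ (≈-trans (×-congʳ (a / p) p·h≈ε) (·-ε (a / p))) ⟩
    (a % p) · h ∙ ε                    ≈⟨ identityʳ _ ⟩
    (a % p) · h                        ∎

  ∑-· : ∀ {K} (J : Mask K) (v : Fin K → ℕ) g → ∑⟨ J ⟩ (λ j → v j · g) ≈ ℕSum.∑⟨ J ⟩ v · g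
  ∑-· {zero} J v g = ≈-refl
  ∑-· {suc K} J v g with J zero
  ... | true = ≈-trans (∙-congˡ (∑-· (J ∘ suc) (v ∘ suc) g)) (≈-sym (×-homo-+ g (v zero) _))
  ... | false = ≈-trans (identityˡ _) (∑-· (J ∘ suc) (v ∘ suc) g)

  ·-⁻¹ : ∀ q {h} → suc q · h ≈ ε → ∀ a → (a · h) ⁻¹ ≈ (a * q) · h
  ·-⁻¹ q {h} order a = ≈-sym (inverseʳ-unique (a · h) ((a * q) · h) (begin
    a · h ∙ (a * q) · h      ≈⟨ ≈-sym (×-homo-+ h a (a * q)) ⟩
    (a + a * q) · h          ≡⟨ cong (_· h) (sym (*-suc a q)) ⟩
    (a * suc q) · h          ≈⟨ ≈-sym (×-assocˡ h a (suc q)) ⟩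
    a · (suc q · h)          ≈⟨ ×-congʳ a order ⟩
    a · ε                    ≈⟨ ·-ε a ⟩
    ε                        ∎))

module FiniteGroup {c ℓ : Level} (G : AbelianGroup c ℓ) {n : ℕ} (ord : HasOrder G n) where
  open AbelianGroup G renaming (refl to ≈-refl; sym to ≈-sym; trans to ≈-trans)
  open HasOrder ord
  open Multiples G
  open import Algebra.Properties.Group group using (∙-cancelʳ)
  open import Relation.Binary.Reasoning.Setoid setoid

  index : Carrier → Fin n
  index x = proj₁ (surjective x)

  enum-index : ∀ x → enum (index x) ≈ x
  enum-index x = proj₂ (surjective x)

  index-≈ : ∀ {x y} → index x ≡ index y → x ≈ y
  index-≈ {x} {y} eq = ≈-trans (≈-sym (enum-index x)) (≈-trans (reflexive (cong enum eq)) (enum-index y))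

  _≈?_ : ∀ x y → Dec (x ≈ y)
  x ≈? y with index x Fin.≟ index y
  ... | yes eq = yes (index-≈ eq)
  ... | no neq = no λ x≈y → neq (injective _ _ (≈-trans (enum-index x) (≈-trans x≈y (≈-sym (enum-index y)))))

  ·-cancel : ∀ {i j} h → i ≤ j → i · h ≈ j · h → (j ∸ i) · h ≈ ε
  ·-cancel {i} {j} h i≤j eq = ∙-cancelʳ (i · h) _ _ (begin
    (j ∸ i) · h ∙ i · h     ≈⟨ ≈-sym (×-homo-+ h (j ∸ i) i) ⟩
    (j ∸ i + i) · h         ≡⟨ cong (_· h) (m∸n+n≡m i≤j) ⟩
    j · h                   ≈⟨ ≈-sym eq ⟩
    i · h                   ≈⟨ ≈-sym (identityˡ _) ⟩
    ε ∙ i · h               ∎)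

  -- Two of the n + 1 multiples 0·g, …, n·g coincide.
  torsion : ∀ g → ∃ λ d → 0 < d × d · g ≈ ε
  torsion g with Finₚ.pigeonhole (n<1+n n) (λ (i : Fin (suc n)) → index (toℕ i · g))
  ... | i , j , i<j , eq = toℕ j ∸ toℕ i , m<n⇒0<n∸m i<j , ·-cancel g (<⇒≤ i<j) (index-≈ eq)

  record PrimeOrderElement : Set (c ⊔ ℓ) where
    field
      q : ℕ
      prime : Prime (suc q)
      h : Carrier
      order : suc q · h ≈ ε
      minimal : ∀ k → 0 < k → k < suc q → ¬ (k · h ≈ ε)

  -- If d is the order of g and p is a prime factor of d, then (d / p)·g has order p.
  primeOrderElement : ∀ g → ¬ (g ≈ ε) → PrimeOrderElement
  primeOrderElement g g≉ε with least order? (proj₂ (torsion g))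
    where
    order? : ∀ m → Dec (0 < m × m · g ≈ ε)
    order? m = (0 <? m) ×-dec ((m · g) ≈? ε)
  ... | d , (0<d , d·g≈ε) , below = fromFactorisation (factorise d {{>-nonZero 0<d}})
    where
    fromFactorisation : PrimeFactorisation d → PrimeOrderElement
    fromFactorisation record { factors = [] ; isFactorisation = d≡1 } =
      contradiction (≈-trans (≈-sym (identityʳ g)) (subst (λ m → m · g ≈ ε) d≡1 d·g≈ε)) g≉ε
    fromFactorisation record { factors = zero ∷ _ ; factorsPrime = 0-prime ∷ _ } =
      contradiction 0-prime λ p → case prime⇒nonZero p of λ ()
    fromFactorisation record { factors = suc q ∷ ps ; isFactorisation = d≡ ; factorsPrime = p-prime ∷ _ } = record
      { q = q ; prime = p-prime ; h = product ps · g
      ; order = ≈-trans (×-assocˡ g (suc q) (product ps)) (subst (λ m → m · g ≈ ε) d≡ d·g≈ε)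
      ; minimal = λ k 0<k k<p k·h≈ε → below (k * product ps) (k*e<d k<p)
                    (0<k*e 0<k , ≈-trans (≈-sym (×-assocˡ g k (product ps))) k·h≈ε) }
      where
      0<e : 0 < product ps
      0<e = n≢0⇒n>0 λ e≡0 → <⇒≢ 0<d (sym (trans d≡ (trans (cong (suc q *_) e≡0) (*-zeroʳ q))))
      k*e<d : ∀ {k} → k < suc q → k * product ps < d
      k*e<d k<p = subst (_ <_) (sym d≡) (*-monoˡ-< (product ps) {{>-nonZero 0<e}} k<p)
      0<k*e : ∀ {k} → 0 < k → 0 < k * product ps
      0<k*e {k} 0<k = subst (_< k * product ps) (*-zeroʳ k) (*-monoʳ-< k {{>-nonZero 0<k}} 0<e)

module Quotient {c ℓ : Level} (G : AbelianGroup c ℓ) (q : ℕ) (h : AbelianGroup.Carrier G)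
                (order : AbelianGroup._≈_ G (Multiples._·_ G (suc q) h) (AbelianGroup.ε G)) where
  open AbelianGroup G renaming (refl to ≈-refl; sym to ≈-sym; trans to ≈-trans)
  open Multiples G
  open import Algebra.Properties.Group group using (⁻¹-involutive; ε⁻¹≈ε)
  open import Algebra.Properties.AbelianGroup G using (⁻¹-∙-comm)
  open import Relation.Binary.Reasoning.Setoid setoid

  infix 4 _~_

  _~_ : Carrier → Carrier → Set ℓ
  x ~ y = ∃ λ a → x ∙ y ⁻¹ ≈ a · h

  ~-refl : ∀ {x} → x ~ x
  ~-refl {x} = 0 , inverseʳ x

  ≈⇒~ : ∀ {x y} → x ≈ y → x ~ y
  ≈⇒~ {x} {y} x≈y = 0 , ≈-trans (∙-congʳ x≈y) (inverseʳ y)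

  ·h~ε : ∀ a → a · h ~ ε
  ·h~ε a = a , ≈-trans (∙-congˡ ε⁻¹≈ε) (identityʳ _)

  ~-sym : ∀ {x y} → x ~ y → y ~ x
  ~-sym {x} {y} (a , x-y≈a·h) = a * q , (begin
    y ∙ x ⁻¹               ≈⟨ comm y (x ⁻¹) ⟩
    x ⁻¹ ∙ y               ≈⟨ ∙-congˡ (≈-sym (⁻¹-involutive y)) ⟩
    x ⁻¹ ∙ (y ⁻¹) ⁻¹       ≈⟨ ⁻¹-∙-comm x (y ⁻¹) ⟩
    (x ∙ y ⁻¹) ⁻¹          ≈⟨ ⁻¹-cong x-y≈a·h ⟩
    (a · h) ⁻¹             ≈⟨ ·-⁻¹ q order a ⟩
    (a * q) · h            ∎)

  ~-trans : ∀ {x y z} → x ~ y → y ~ z → x ~ z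
  ~-trans {x} {y} {z} (a , x-y≈a·h) (b , y-z≈b·h) = a + b , (begin
    x ∙ z ⁻¹                   ≈⟨ ∙-congˡ (≈-sym (identityˡ (z ⁻¹))) ⟩
    x ∙ (ε ∙ z ⁻¹)             ≈⟨ ∙-congˡ (∙-congʳ (≈-sym (inverseˡ y))) ⟩
    x ∙ ((y ⁻¹ ∙ y) ∙ z ⁻¹)    ≈⟨ ∙-congˡ (assoc (y ⁻¹) y (z ⁻¹)) ⟩
    x ∙ (y ⁻¹ ∙ (y ∙ z ⁻¹))    ≈⟨ ≈-sym (assoc x (y ⁻¹) (y ∙ z ⁻¹)) ⟩
    (x ∙ y ⁻¹) ∙ (y ∙ z ⁻¹)    ≈⟨ ∙-cong x-y≈a·h y-z≈b·h ⟩
    a · h ∙ b · h              ≈⟨ ≈-sym (×-homo-+ h a b) ⟩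
    (a + b) · h                ∎)

  ~-∙ : ∀ {x y u v} → x ~ y → u ~ v → x ∙ u ~ y ∙ v
  ~-∙ {x} {y} {u} {v} (a , x-y≈a·h) (b , u-v≈b·h) = a + b , (begin
    (x ∙ u) ∙ (y ∙ v) ⁻¹       ≈⟨ ∙-congˡ (≈-sym (⁻¹-∙-comm y v)) ⟩
    (x ∙ u) ∙ (y ⁻¹ ∙ v ⁻¹)    ≈⟨ interchange x u (y ⁻¹) (v ⁻¹) ⟩
    (x ∙ y ⁻¹) ∙ (u ∙ v ⁻¹)    ≈⟨ ∙-cong x-y≈a·h u-v≈b·h ⟩
    a · h ∙ b · h              ≈⟨ ≈-sym (×-homo-+ h a b) ⟩
    (a + b) · h                ∎)
    where open import Algebra.Properties.CommutativeSemigroup commutativeSemigroup using (interchange)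

  ~-⁻¹ : ∀ {x y} → x ~ y → x ⁻¹ ~ y ⁻¹
  ~-⁻¹ {x} {y} (a , x-y≈a·h) = a * q ,
    ≈-trans (⁻¹-∙-comm x (y ⁻¹)) (≈-trans (⁻¹-cong x-y≈a·h) (·-⁻¹ q order a))

  G/⟨h⟩ : AbelianGroup c ℓ
  G/⟨h⟩ = record
    { Carrier = Carrier ; _≈_ = _~_ ; _∙_ = _∙_ ; ε = ε ; _⁻¹ = _⁻¹
    ; isAbelianGroup = record
      { isGroup = record
        { isMonoid = record
          { isSemigroup = record
            { isMagma = record
              { isEquivalence = record { refl = ~-refl ; sym = ~-sym ; trans = ~-trans }
              ; ∙-cong = ~-∙ }
            ; assoc = λ x y z → ≈⇒~ (assoc x y z) }
          ; identity = (λ x → ≈⇒~ (identityˡ x)) , (λ x → ≈⇒~ (identityʳ x)) }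
        ; inverse = (λ x → ≈⇒~ (inverseˡ x)) , (λ x → ≈⇒~ (inverseʳ x))
        ; ⁻¹-cong = ~-⁻¹ }
      ; comm = λ x y → ≈⇒~ (comm x y) } }

module Lagrange {c ℓ : Level} (G : AbelianGroup c ℓ) {n : ℕ} (ord : HasOrder G n)
                (q : ℕ) (h : AbelianGroup.Carrier G)
                (order : AbelianGroup._≈_ G (Multiples._·_ G (suc q) h) (AbelianGroup.ε G))
                (minimal : ∀ k → 0 < k → k < suc q → ¬ AbelianGroup._≈_ G (Multiples._·_ G k h) (AbelianGroup.ε G)) where
  open AbelianGroup G renaming (refl to ≈-refl; sym to ≈-sym; trans to ≈-trans)
  open HasOrder ord
  open FiniteGroup G ord
  open Multiples G
  open Quotient G q h order
  open import Algebra.Properties.Group group using (∙-cancelˡ)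
  open import Relation.Binary.Reasoning.Setoid setoid

  p : ℕ
  p = suc q

  _~?_ : ∀ x y → Dec (x ~ y)
  x ~? y with Finₚ.any? (λ (k : Fin p) → (x ∙ y ⁻¹) ≈? (toℕ k · h))
  ... | yes (k , x-y≈k·h) = yes (toℕ k , x-y≈k·h)
  ... | no none = no λ (a , x-y≈a·h) → none (fromℕ< (m%n<n a p) ,
          ≈-trans x-y≈a·h (≈-trans (·-% p order a) (reflexive (cong (_· h) (sym (Finₚ.toℕ-fromℕ< (m%n<n a p)))))))

  ·h-injective : ∀ (k l : Fin p) → toℕ k · h ≈ toℕ l · h → k ≡ l
  ·h-injective k l k·h≈l·h with <-cmp (toℕ k) (toℕ l)
  ... | tri< k<l _ _ = ⊥-elim (minimal _ (m<n⇒0<n∸m k<l) (≤-trans (s≤s (m∸n≤m (toℕ l) (toℕ k))) (Finₚ.toℕ<n l))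
                                  (·-cancel h (<⇒≤ k<l) k·h≈l·h))
  ... | tri≈ _ k≡l _ = Finₚ.toℕ-injective k≡l
  ... | tri> _ _ l<k = ⊥-elim (minimal _ (m<n⇒0<n∸m l<k) (≤-trans (s≤s (m∸n≤m (toℕ k) (toℕ l))) (Finₚ.toℕ<n k))
                                  (·-cancel h (<⇒≤ l<k) (≈-sym k·h≈l·h)))

  IsRepresentative : Fin n → Set ℓ
  IsRepresentative i = ∀ j → toℕ j < toℕ i → ¬ (enum j ~ enum i)

  isRepresentative? : ∀ i → Dec (IsRepresentative i)
  isRepresentative? i = Finₚ.all? λ j → toℕ j <? toℕ i →-dec ¬? (enum j ~? enum i)

  representatives : Mask n
  representatives i = does (isRepresentative? i)

  m : ℕ
  m = count representatives

  rep : Fin m → Carrier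
  rep = enum ∘ enumerate representatives

  rep-injective : ∀ a b → rep a ~ rep b → a ≡ b
  rep-injective a b ra~rb with <-cmp (toℕ (enumerate representatives a)) (toℕ (enumerate representatives b))
  ... | tri< i<j _ _ = ⊥-elim (dec-true⁻¹ (isRepresentative? _) (enumerate-∈ representatives b) _ i<j ra~rb)
  ... | tri≈ _ i≡j _ = enumerate-injective representatives (Finₚ.toℕ-injective i≡j)
  ... | tri> _ _ j<i = ⊥-elim (dec-true⁻¹ (isRepresentative? _) (enumerate-∈ representatives a) _ j<i (~-sym ra~rb))

  -- The least index of an element of the coset of x is a representative.
  rep-surjective : ∀ x → ∃ λ a → rep a ~ x
  rep-surjective x with least InCoset? {toℕ (index x)} (Finₚ.toℕ<n (index x) , coset-of-index)
    where
    InCoset : ℕ → Set ℓ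
    InCoset i = Σ (i < n) λ i<n → enum (fromℕ< i<n) ~ x
    InCoset? : ∀ i → Dec (InCoset i)
    InCoset? i with i <? n
    ... | no i≮n = no (i≮n ∘ proj₁)
    ... | yes i<n = map′ (i<n ,_) proj₂ (enum (fromℕ< i<n) ~? x)
    coset-of-index : enum (fromℕ< (Finₚ.toℕ<n (index x))) ~ x
    coset-of-index = ≈⇒~ (≈-trans (reflexive (cong enum (Finₚ.fromℕ<-toℕ (index x) _))) (enum-index x))
  ... | i , (i<n , i~x) , below with enumerate-surjective representatives {fromℕ< i<n} (dec-true (isRepresentative? (fromℕ< i<n)) least-index)
    where
    least-index : IsRepresentative (fromℕ< i<n)
    least-index j j<i j~i = below (toℕ j) (subst (toℕ j <_) (Finₚ.toℕ-fromℕ< i<n) j<i)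
      (Finₚ.toℕ<n j , subst (λ j → enum j ~ x) (sym (Finₚ.fromℕ<-toℕ j _)) (~-trans j~i i~x))
  ... | a , a↦i = a , subst (λ j → enum j ~ x) (sym a↦i) i~x

  order-G/⟨h⟩ : HasOrder G/⟨h⟩ m
  order-G/⟨h⟩ = record { enum = rep ; injective = rep-injective ; surjective = rep-surjective }

  compose : Fin m × Fin p → Carrier
  compose (a , k) = rep a ∙ toℕ k · h

  compose~rep : ∀ a k → compose (a , k) ~ rep a
  compose~rep a k = ~-trans (~-∙ ~-refl (·h~ε (toℕ k))) (≈⇒~ (identityʳ _))

  compose-injective : ∀ {u v} → compose u ≈ compose v → u ≡ v
  compose-injective {a , k} {b , l} eq = cong₂ _,_ a≡b (·h-injective k l (∙-cancelˡ (rep a) _ _ (begin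
    rep a ∙ toℕ k · h    ≈⟨ eq ⟩
    rep b ∙ toℕ l · h    ≡⟨ cong (λ c → rep c ∙ toℕ l · h) (sym a≡b) ⟩
    rep a ∙ toℕ l · h    ∎)))
    where
    a≡b : a ≡ b
    a≡b = rep-injective a b (~-trans (~-sym (compose~rep a k)) (~-trans (≈⇒~ eq) (compose~rep b l)))

  decompose : Carrier → Fin m × Fin p
  decompose x = proj₁ (rep-surjective x) , fromℕ< (m%n<n (proj₁ (~-sym (proj₂ (rep-surjective x)))) p)

  compose-decompose : ∀ x → compose (decompose x) ≈ x
  compose-decompose x = begin
    rep a ∙ toℕ (fromℕ< (m%n<n b p)) · h    ≡⟨ cong (λ k → rep a ∙ k · h) (Finₚ.toℕ-fromℕ< (m%n<n b p)) ⟩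
    rep a ∙ (b % p) · h                     ≈⟨ ∙-congˡ (≈-sym (·-% p order b)) ⟩
    rep a ∙ b · h                           ≈⟨ ∙-congˡ (≈-sym x-a≈b·h) ⟩
    rep a ∙ (x ∙ rep a ⁻¹)                  ≈⟨ comm _ _ ⟩
    (x ∙ rep a ⁻¹) ∙ rep a                  ≈⟨ assoc _ _ _ ⟩
    x ∙ (rep a ⁻¹ ∙ rep a)                  ≈⟨ ∙-congˡ (inverseˡ _) ⟩
    x ∙ ε                                   ≈⟨ identityʳ x ⟩
    x                                       ∎
    where
    a = proj₁ (rep-surjective x)
    b = proj₁ (~-sym (proj₂ (rep-surjective x)))
    x-a≈b·h = proj₂ (~-sym (proj₂ (rep-surjective x)))

  decompose-injective : ∀ {i j} → decompose (enum i) ≡ decompose (enum j) → i ≡ j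
  decompose-injective {i} {j} eq = injective i j (begin
    enum i                        ≈⟨ ≈-sym (compose-decompose (enum i)) ⟩
    compose (decompose (enum i))  ≡⟨ cong compose eq ⟩
    compose (decompose (enum j))  ≈⟨ compose-decompose (enum j) ⟩
    enum j                        ∎)

  n≡m*p : n ≡ m * p
  n≡m*p = ≤-antisym (Finₚ.injective⇒≤ {f = to} to-injective) (Finₚ.injective⇒≤ {f = from} from-injective)
    where
    to : Fin n → Fin (m * p)
    to = uncurry Fin.combine ∘ decompose ∘ enum
    to-injective : ∀ {i j} → to i ≡ to j → i ≡ j
    to-injective {i} {j} eq = decompose-injective (cong₂ _,_
      (proj₁ (Finₚ.combine-injective (proj₁ (decompose (enum i))) (proj₂ (decompose (enum i)))
                                     (proj₁ (decompose (enum j))) (proj₂ (decompose (enum j))) eq))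
      (proj₂ (Finₚ.combine-injective (proj₁ (decompose (enum i))) (proj₂ (decompose (enum i)))
                                     (proj₁ (decompose (enum j))) (proj₂ (decompose (enum j))) eq)))
    from : Fin (m * p) → Fin n
    from = index ∘ compose ∘ Fin.remQuot {m} p
    from-injective : ∀ {u v} → from u ≡ from v → u ≡ v
    from-injective {u} {v} eq = trans (sym (Finₚ.combine-remQuot {m} p u))
      (trans (cong (uncurry Fin.combine) (compose-injective (index-≈ eq))) (Finₚ.combine-remQuot {m} p v))

-- The Erdős–Ginzburg–Ziv theorem for finite abelian groups

-- Room left for one more block of m terms after j < 2p − 1 blocks have been removed.
block-room : ∀ m q j R → j ≤ q + q → m * suc q + m * suc q ≤ R + j * m → m + m ≤ R
block-room m q j R j≤2q hyp = +-cancelʳ-≤ (m * q + m * q) (m + m) R (begin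
  m + m + (m * q + m * q)   ≡⟨ solve 2 (λ m q → m :+ m :+ (m :* q :+ m :* q) := m :* (con 1 :+ q) :+ m :* (con 1 :+ q)) refl m q ⟩
  m * suc q + m * suc q     ≤⟨ hyp ⟩
  R + j * m                 ≤⟨ +-monoʳ-≤ R (*-monoˡ-≤ m j≤2q) ⟩
  R + (q + q) * m           ≡⟨ cong (R +_) (solve 2 (λ m q → (q :+ q) :* m := m :* q :+ m :* q) refl m q) ⟩
  R + (m * q + m * q)       ∎)
  where
  open ≤-Reasoning
  open +-*-Solver

module Multiplicativity {c ℓ : Level} (G : AbelianGroup c ℓ) (q : ℕ) (prime : Prime (suc q))
                        (h : AbelianGroup.Carrier G)
                        (order : AbelianGroup._≈_ G (Multiples._·_ G (suc q) h) (AbelianGroup.ε G))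
                        (m : ℕ) (egz-quotient : EGZ (Quotient.G/⟨h⟩ G q h order) m) where
  open AbelianGroup G renaming (refl to ≈-refl; sym to ≈-sym; trans to ≈-trans)
  open MaskedSum commutativeMonoid
  open Multiples G
  open import Algebra.Properties.Group group using (ε⁻¹≈ε)
  open import Relation.Binary.Reasoning.Setoid setoid

  p : ℕ
  p = suc q

  module _ {k : ℕ} (x : Fin k → Carrier) (T : Mask k) where

    record Blocks (j : ℕ) : Set (c ⊔ ℓ) where
      field
        B : Fin j → Mask k
        v : Fin j → ℕ
        B⊆T : ∀ i → B i ⊆ T
        #B : ∀ i → count (B i) ≡ m
        ∑B : ∀ i → ∑⟨ B i ⟩ x ≈ v i · h
        disjoint : PairwiseDisjoint B
        #⋃B : count (⋃ full B) ≡ j * m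

    no-blocks : Blocks 0
    no-blocks = record { B = λ () ; v = λ () ; B⊆T = λ () ; #B = λ () ; ∑B = λ () ; disjoint = λ () ; #⋃B = count-∅ {k} }

    -- The blocks are extracted one at a time from the remaining terms with the EGZ property of G/⟨h⟩.
    more-blocks : m * p + m * p ≤ suc (count T) → ∀ j → j ≤ q + q → Blocks j → Blocks (suc j)
    more-blocks room j j≤2q blocks = record
      { B = S Vector.∷ B ; v = a Vector.∷ v
      ; B⊆T = λ { zero i i∈S → ∖-⊆ T (⋃ full B) i (S⊆R i i∈S) ; (suc i) → B⊆T i }
      ; #B = λ { zero → #S ; (suc i) → #B i }
      ; ∑B = λ { zero → ≈-trans (≈-sym (≈-trans (∙-congˡ ε⁻¹≈ε) (identityʳ _))) S-ε≈a·h ; (suc i) → ∑B i }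
      ; disjoint = disjoint′
      ; #⋃B = trans (count-∪ S (⋃ full B) S∩⋃B) (cong₂ _+_ #S #⋃B) }
      where
      open Blocks blocks
      R = T ∖ ⋃ full B
      #R : count R + j * m ≡ count T
      #R = trans (cong (count R +_) (sym #⋃B)) (count-∖ (⋃-⊆ full B B⊆T))
      found = egz-quotient x R (block-room m q j (suc (count R)) j≤2q (subst (m * p + m * p ≤_) (cong suc (sym #R)) room))
      S = proj₁ found
      S⊆R = proj₁ (proj₂ found)
      #S = proj₁ (proj₂ (proj₂ found))
      a : ℕ
      a = proj₁ (proj₂ (proj₂ (proj₂ found)))
      S-ε≈a·h : ∑⟨ S ⟩ x ∙ ε ⁻¹ ≈ a · h
      S-ε≈a·h = proj₂ (proj₂ (proj₂ (proj₂ found)))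
      S∩⋃B : Disjoint S (⋃ full B)
      S∩⋃B = disjoint-⊆ S⊆R (λ _ i∈ → i∈) (∖-disjoint T (⋃ full B))
      S∩B : ∀ i → Disjoint S (B i)
      S∩B i = disjoint-⊆ (λ _ i∈ → i∈) (∈-⋃⁺ full B i refl) S∩⋃B
      disjoint′ : PairwiseDisjoint (S Vector.∷ B)
      disjoint′ zero zero 0≢0 = contradiction refl 0≢0
      disjoint′ zero (suc i) _ = S∩B i
      disjoint′ (suc i) zero _ = disjoint-sym (S∩B i)
      disjoint′ (suc i) (suc j) i≢j = disjoint i j (i≢j ∘ cong suc)

    blocks : m * p + m * p ≤ suc (count T) → ∀ j → j ≤ suc (q + q) → Blocks j
    blocks room zero _ = no-blocks
    blocks room (suc j) j≤2q+1 = more-blocks room j (≤-pred j≤2q+1) (blocks room j (≤-trans (n≤1+n j) j≤2q+1))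

  egz : EGZ G (m * p)
  egz x T room = ⋃ J B , ⋃-⊆ J B B⊆T , #⋃ , ∑⋃
    where
    open Blocks (blocks x T room (suc (q + q)) ≤-refl)
    found = PrimeEGZ.egz q prime v full (subst (λ K → p + p ≤ suc K) (sym count-full) (≤-reflexive (cong suc (+-suc q q))))
    J = proj₁ found
    #J = proj₁ (proj₂ (proj₂ found))
    ∑J%p = proj₂ (proj₂ (proj₂ found))
    #⋃ : count (⋃ J B) ≡ m * p
    #⋃ = trans (ℕSum.∑-⋃ J B (const 1) disjoint) (trans (ℕSum.∑-cong J (λ j _ → #B j))
           (trans (∑ℕ-const J m) (trans (cong (_* m) #J) (*-comm p m))))
    ∑⋃ : ∑⟨ ⋃ J B ⟩ x ≈ ε
    ∑⋃ = begin
      ∑⟨ ⋃ J B ⟩ x                       ≈⟨ ∑-⋃ J B x disjoint ⟩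
      ∑⟨ J ⟩ (λ j → ∑⟨ B j ⟩ x)          ≈⟨ ∑-cong J (λ j _ → ∑B j) ⟩
      ∑⟨ J ⟩ (λ j → v j · h)             ≈⟨ ∑-· J v h ⟩
      ℕSum.∑⟨ J ⟩ v · h                  ≈⟨ ·-% p order (ℕSum.∑⟨ J ⟩ v) ⟩
      (ℕSum.∑⟨ J ⟩ v % p) · h            ≡⟨ cong (_· h) ∑J%p ⟩
      ε                                  ∎

module _ {c ℓ : Level} (G : AbelianGroup c ℓ) where
  open AbelianGroup G renaming (refl to ≈-refl; sym to ≈-sym; trans to ≈-trans)
  open MaskedSum commutativeMonoid

  egz-trivial : HasOrder G 1 → EGZ G 1
  egz-trivial ord x T room = ⁅ e ⁆ , ⁅⁆-⊆ {S = T} e∈T , count-⁅⁆ e , ≈-trans (∑-⁅⁆ e x) (trivial (x e))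
    where
    open HasOrder ord
    e∈ = count-nonempty T (≤-pred room)
    e = proj₁ e∈
    e∈T = proj₂ e∈
    trivial : ∀ y → y ≈ ε
    trivial y with surjective y | surjective ε
    ... | zero , enum≈y | zero , enum≈ε = ≈-trans (≈-sym enum≈y) enum≈ε

  nonidentity : ∀ {n} → HasOrder G (suc (suc n)) → ∃ λ g → ¬ (g ≈ ε)
  nonidentity ord with enum zero ≈? ε | enum (suc zero) ≈? ε
    where
    open HasOrder ord
    open FiniteGroup G ord
  ... | no e₀≉ε | _ = _ , e₀≉ε
  ... | yes _ | no e₁≉ε = _ , e₁≉ε
  ... | yes e₀≈ε | yes e₁≈ε = contradiction (HasOrder.injective ord zero (suc zero) (≈-trans e₀≈ε (≈-sym e₁≈ε))) λ ()

egz-finite : ∀ {c ℓ} n (G : AbelianGroup c ℓ) → HasOrder G n → EGZ G n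
egz-finite {c} {ℓ} = <-rec (λ n → (G : AbelianGroup c ℓ) → HasOrder G n → EGZ G n) step
  where
  step : ∀ n → (∀ {m} → m < n → (Q : AbelianGroup c ℓ) → HasOrder Q m → EGZ Q m) →
         (G : AbelianGroup c ℓ) → HasOrder G n → EGZ G n
  step zero _ G ord = case proj₁ (HasOrder.surjective ord (AbelianGroup.ε G)) of λ ()
  step (suc zero) _ G ord = egz-trivial G ord
  step (suc (suc n)) smaller G ord = subst (EGZ G) (sym n≡m*p)
    (Multiplicativity.egz G q prime h order m (smaller m<n G/⟨h⟩ order-G/⟨h⟩))
    where
    open FiniteGroup G ord using (primeOrderElement; module PrimeOrderElement)
    open PrimeOrderElement (primeOrderElement (proj₁ (nonidentity G ord)) (proj₂ (nonidentity G ord)))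
    open Quotient G q h order using (G/⟨h⟩)
    open Lagrange G ord q h order minimal using (m; order-G/⟨h⟩; n≡m*p)
    m<n : m < suc (suc n)
    m<n = quotient-smaller m (sym n≡m*p)
      where
      quotient-smaller : ∀ m → m * suc q ≡ suc (suc n) → m < suc (suc n)
      quotient-smaller (suc m) eq = subst (suc m <_) eq (m<m*n (suc m) (suc q) (nonTrivial⇒n>1 (suc q) {{prime⇒nonTrivial prime}}))

-- Weighted zero-sum subsequences

egz-length : ∀ {n} → 0 < n → 0 < 2 * n ∸ 1 × n + n ≤ suc (2 * n ∸ 1)
egz-length {suc n} _ = ≤-trans (s≤s z≤n) (m≤n+m (suc (n + 0)) n) ,
                       ≤-reflexive (cong (λ z → suc (n + suc z)) (sym (+-identityʳ n)))

module WeightedZeroSums {r ℓr m ℓm ℓa ℓb : Level} {R : Ring r ℓr} (M : LeftModule R m ℓm)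
                        {A : Pred (Ring.Carrier R) ℓa} {B : Pred (Ring.Carrier R) ℓb}
                        {a b : Ring.Carrier R} (a∈A : A a) (b∈B : B b)
                        {c : ℕ} (char : HasCharacteristic R c) where
  module R = Ring R
  open LeftModule M

  natCast-+ : ∀ x y → natCast R (x + y) R.≈ natCast R x R.+ natCast R y
  natCast-+ zero y = R.sym (R.+-identityˡ _)
  natCast-+ (suc x) y = R.trans (R.+-congˡ (natCast-+ x y)) (R.sym (R.+-assoc _ _ _))

  natCast-*c : ∀ k → natCast R (k * c) R.≈ R.0#
  natCast-*c zero = R.refl
  natCast-*c (suc k) = R.trans (natCast-+ c (k * c))
    (R.trans (R.+-cong (proj₁ (proj₂ char)) (natCast-*c k)) (R.+-identityˡ R.0#))

  sumR-const : ∀ l z → sumR R {l} (const z) R.≈ natCast R l R.* z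
  sumR-const zero z = R.sym (R.zeroˡ z)
  sumR-const (suc l) z = R.trans (R.+-cong (R.sym (R.*-identityˡ z)) (sumR-const l z))
    (R.sym (R.distribʳ z R.1# (natCast R l)))

  sumM-*ₗ : ∀ {l} (y : Fin l → Carrierᴹ) → sumM M (λ i → a *ₗ y i) ≈ᴹ a *ₗ sumM M y
  sumM-*ₗ {zero} y = ≈ᴹ-sym (*ₗ-zeroʳ a)
  sumM-*ₗ {suc l} y = ≈ᴹ-trans (+ᴹ-congˡ (sumM-*ₗ (y ∘ suc))) (≈ᴹ-sym (*ₗ-distribˡ a _ _))

  zeroSum⇒weighted : ∀ {l} (y : Fin l → Carrierᴹ) → c ∣ l → sumM M y ≈ᴹ 0ᴹ → WeightedZeroSum M A B y
  zeroSum⇒weighted {l} y (divides k l≡k*c) ∑y≈0 = const a , const b , const a∈A , const b∈B ,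
    ≈ᴹ-trans (sumM-*ₗ y) (≈ᴹ-trans (*ₗ-congˡ ∑y≈0) (*ₗ-zeroʳ a)) ,
    R.trans (sumR-const l (b R.* a))
      (R.trans (R.*-congʳ (subst (λ n → natCast R n R.≈ R.0#) (sym l≡k*c) (natCast-*c k))) (R.zeroˡ _))

  open MaskedSum +ᴹ-commutativeMonoid
  open import Algebra.Properties.Monoid.Sum +ᴹ-monoid using (sum)

  sumM≈sum : ∀ {l} (y : Fin l → Carrierᴹ) → sumM M y ≈ᴹ sum y
  sumM≈sum {zero} y = ≈ᴹ-refl
  sumM≈sum {suc l} y = +ᴹ-congˡ (sumM≈sum (y ∘ suc))

  weightedSubsequence : ∀ {k N} (x : Fin k → Carrierᴹ) (S : Mask k) → count S ≡ N → 0 < N → c ∣ N →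
                        ∑⟨ S ⟩ x ≈ᴹ 0ᴹ → HasWZSOfLength M A B N x
  weightedSubsequence x S refl 0<N c∣N ∑≈0 = enumerate S , 0<N , enumerate-increasing S ,
    zeroSum⇒weighted (x ∘ enumerate S) c∣N
      (≈ᴹ-trans (sumM≈sum (x ∘ enumerate S)) (≈ᴹ-trans (sum-enumerate +ᴹ-commutativeMonoid S x) ∑≈0))

  partial : (ℕ → Carrierᴹ) → ℕ → Carrierᴹ
  partial g zero = 0ᴹ
  partial g (suc l) = g 0 +ᴹ partial (g ∘ suc) l

  partial-+ : ∀ g s l → partial g (s + l) ≈ᴹ partial g s +ᴹ partial (λ i → g (s + i)) l
  partial-+ g zero l = ≈ᴹ-sym (+ᴹ-identityˡ _)
  partial-+ g (suc s) l = ≈ᴹ-trans (+ᴹ-congˡ (partial-+ (g ∘ suc) s l)) (≈ᴹ-sym (+ᴹ-assoc _ _ _))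

  sumM≈partial : ∀ {l} (y : Fin l → Carrierᴹ) g → (∀ i → y i ≈ᴹ g (toℕ i)) → sumM M y ≈ᴹ partial g l
  sumM≈partial {zero} y g _ = ≈ᴹ-refl
  sumM≈partial {suc l} y g y≈g = +ᴹ-cong (y≈g zero) (sumM≈partial (y ∘ suc) (g ∘ suc) (y≈g ∘ suc))

  consecutiveBlock : ∀ {k} (x : Fin k → Carrierᴹ) g → (∀ i → x i ≈ᴹ g (toℕ i)) →
                     ∀ {s t} → s < t → t ≤ k → partial g s ≈ᴹ partial g t → c ∣ t ∸ s → HasConsecutiveWZS M A B x
  consecutiveBlock {k} x g x≈g {s} {t} s<t t≤k equal c∣t∸s =
    t ∸ s , σ , m<n⇒0<n∸m s<t , σ-increasing , (s , λ i → Finₚ.toℕ-fromℕ< (in-range i)) ,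
    zeroSum⇒weighted (x ∘ σ) c∣t∸s (≈ᴹ-trans (sumM≈partial (x ∘ σ) (λ i → g (s + i)) σ≈g) block≈0)
    where
    s+l≡t : s + (t ∸ s) ≡ t
    s+l≡t = m+[n∸m]≡n (<⇒≤ s<t)
    in-range : ∀ (i : Fin (t ∸ s)) → s + toℕ i < k
    in-range i = ≤-trans (subst (s + toℕ i <_) s+l≡t (+-monoʳ-< s (Finₚ.toℕ<n i))) t≤k
    σ : Fin (t ∸ s) → Fin k
    σ i = fromℕ< (in-range i)
    σ-increasing : ∀ i j → toℕ i < toℕ j → toℕ (σ i) < toℕ (σ j)
    σ-increasing i j i<j = subst₂ _<_ (sym (Finₚ.toℕ-fromℕ< (in-range i))) (sym (Finₚ.toℕ-fromℕ< (in-range j)))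
                             (+-monoʳ-< s i<j)
    σ≈g : ∀ i → x (σ i) ≈ᴹ g (s + toℕ i)
    σ≈g i = ≈ᴹ-trans (x≈g (σ i)) (≈ᴹ-reflexive (cong g (Finₚ.toℕ-fromℕ< (in-range i))))
    block≈0 : partial (λ i → g (s + i)) (t ∸ s) ≈ᴹ 0ᴹ
    block≈0 = +ᴹ-cancelˡ (partial g s) _ _ (≈ᴹ-trans (≈ᴹ-sym (partial-+ g s (t ∸ s)))
      (≈ᴹ-trans (≈ᴹ-reflexive (cong (partial g) s+l≡t)) (≈ᴹ-trans (≈ᴹ-sym equal) (≈ᴹ-sym (+ᴹ-identityʳ _)))))
      where open import Algebra.Properties.Group +ᴹ-group using () renaming (∙-cancelˡ to +ᴹ-cancelˡ)

  module _ {n : ℕ} (size : HasSize M n) where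

    group-order : HasOrder +ᴹ-abelianGroup n
    group-order = record
      { enum = HasSize.enum size ; injective = HasSize.injective size ; surjective = HasSize.surjective size }

    0<n : 0 < n
    0<n = ≤-trans (s≤s z≤n) (Finₚ.toℕ<n (proj₁ (HasSize.surjective size 0ᴹ)))

    E-bound : c ∣ n → E-atMost M A B n (2 * n ∸ 1)
    E-bound c∣n = 2 * n ∸ 1 , proj₁ (egz-length 0<n) , ≤-refl , λ x →
      let S , _ , #S , ∑S≈0 = egz-finite n +ᴹ-abelianGroup group-order x full
                                (subst (λ K → n + n ≤ suc K) (sym count-full) (proj₂ (egz-length 0<n)))
      in weightedSubsequence x S #S 0<n c∣n ∑S≈0

    C-bound : C-atMost M A B (n * c)
    C-bound = n * c , subst (_< n * c) (*-zeroʳ n) (*-monoʳ-< n {{>-nonZero 0<n}} (proj₁ char)) , ≤-refl , consecutive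
      where
      instance
        c≢0 : NonZero c
        c≢0 = >-nonZero (proj₁ char)
      open FiniteGroup +ᴹ-abelianGroup group-order using (index; index-≈)

      extend : (Fin (n * c) → Carrierᴹ) → ℕ → Carrierᴹ
      extend x j with j <? n * c
      ... | yes j<k = x (fromℕ< j<k)
      ... | no _ = 0ᴹ

      x≈extend : ∀ x i → x i ≈ᴹ extend x (toℕ i)
      x≈extend x i with toℕ i <? n * c
      ... | yes i<k = ≈ᴹ-reflexive (cong x (sym (Finₚ.fromℕ<-toℕ i i<k)))
      ... | no i≮k = contradiction (Finₚ.toℕ<n i) i≮k

      -- n·c + 1 prefixes, but only n·c pairs (partial sum, length mod c).
      label : (Fin (n * c) → Carrierᴹ) → Fin (suc (n * c)) → Fin (n * c)
      label x t = Fin.combine (index (partial (extend x) (toℕ t))) (fromℕ< (m%n<n (toℕ t) c))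

      consecutive : (x : Fin (n * c) → Carrierᴹ) → HasConsecutiveWZS M A B x
      consecutive x with Finₚ.pigeonhole (n<1+n (n * c)) (label x)
      ... | i , j , i<j , same-label = consecutiveBlock x (extend x) (x≈extend x) i<j (Finₚ.toℕ≤pred[n] j)
            (index-≈ (proj₁ same)) (%≡%⇒∣∸ c (<⇒≤ i<j) same-residue)
        where
        same = Finₚ.combine-injective (index (partial (extend x) (toℕ i))) (fromℕ< (m%n<n (toℕ i) c))
                                      (index (partial (extend x) (toℕ j))) (fromℕ< (m%n<n (toℕ j) c)) same-label
        same-residue : toℕ i % c ≡ toℕ j % c
        same-residue = trans (sym (Finₚ.toℕ-fromℕ< (m%n<n (toℕ i) c)))
                         (trans (cong toℕ (proj₂ same)) (Finₚ.toℕ-fromℕ< (m%n<n (toℕ j) c)))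

C-atMost-mono : ∀ {r ℓr m ℓm ℓa ℓb} {R : Ring r ℓr} (M : LeftModule R m ℓm)
                (A : Pred (Ring.Carrier R) ℓa) (B : Pred (Ring.Carrier R) ℓb) {N N′} →
                N ≤ N′ → C-atMost M A B N → C-atMost M A B N′
C-atMost-mono M A B N≤N′ (k , 0<k , k≤N , holds) = k , 0<k , ≤-trans k≤N N≤N′ , holds

theorem1 : ∀ {r ℓr m ℓm ℓa ℓb : Level} (R : Ring r ℓr) (M : LeftModule R m ℓm)
    → NonZeroRing R
    → (c : ℕ) → HasCharacteristic R c
    → (n : ℕ) → HasSize M n
    → c ∣ n
    → (A : Pred (Ring.Carrier R) ℓa) → (B : Pred (Ring.Carrier R) ℓb)
    → ∃ A → ∃ B
    → C-atMost M A B (n * n) × E-atMost M A B n (2 * n ∸ 1)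
theorem1 R M _ c char n size c∣n A B (a , a∈A) (b , b∈B) =
  C-atMost-mono M A B (*-monoʳ-≤ n (∣⇒≤ {{>-nonZero (0<n size)}} c∣n)) (C-bound size) , E-bound size c∣n
  where open WeightedZeroSums M {A} {B} {a} {b} a∈A b∈B char
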